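{- Let $\varphi_3\colon\mathrm{GL}_2(\mathbb Z_3)\to\mathfrak S_3$ be the surjective homomorphism obtained by composing reduction modulo $3$, the quotient map $\mathrm{GL}_2(\mathbb F_3)\to\mathrm{GL}_2(\mathbb F_3)/[\mathrm{SL}_2(\mathbb F_3),\mathrm{SL}_2(\mathbb F_3)]$, and an isomorphism of the latter group with the symmetric group $\mathfrak S_3$. If $H$ is a closed normal subgroup of $\mathrm{GL}_2(\mathbb Z_3)$, then either $\varphi_3(H)=1$ or $H\supseteq\mathrm{SL}_2(\mathbb Z_3)$. -}

module Defs where

open import Data.Nat using (ℕ; zero; suc; _+_; _*_; _∸_; _^_; _<_; _%_)
open import Data.Nat.Properties using (m^n≢0)
open import Data.Product using (_×_; Σ; ∃; _,_)
open import Relation.Binary.PropositionalEquality using (_≡_)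

-- 3-adic integers ℤ₃ = lim ℤ/3ⁿ, represented as compatible sequences
-- of residues x n ∈ {0,…,3ⁿ-1} with x (n+1) ≡ x n (mod 3ⁿ).

Seq : Set
Seq = ℕ → ℕ

md : ℕ → ℕ → ℕ
md n a = _%_ a (3 ^ n) {{m^n≢0 3 n}}

IsZ₃ : Seq → Set
IsZ₃ x = (∀ n → x n < 3 ^ n) × (∀ n → md n (x (suc n)) ≡ x n)

_+₃_ : Seq → Seq → Seq
(x +₃ y) n = md n (x n + y n)

_*₃_ : Seq → Seq → Seq
(x *₃ y) n = md n (x n * y n)

-₃_ : Seq → Seq
(-₃ x) n = md n (3 ^ n ∸ x n)

0₃ : Seq
0₃ n = md n 0

1₃ : Seq
1₃ n = md n 1

_≈₃_ : Seq → Seq → Set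
x ≈₃ y = ∀ n → x n ≡ y n

record M2 : Set where
  constructor mat
  field
    a b c d : Seq
open M2 public

IsMat : M2 → Set
IsMat M = IsZ₃ (a M) × IsZ₃ (b M) × IsZ₃ (c M) × IsZ₃ (d M)

_⊗_ : M2 → M2 → M2
M ⊗ N = mat ((a M *₃ a N) +₃ (b M *₃ c N)) ((a M *₃ b N) +₃ (b M *₃ d N))
            ((c M *₃ a N) +₃ (d M *₃ c N)) ((c M *₃ b N) +₃ (d M *₃ d N))

I₂ : M2
I₂ = mat 1₃ 0₃ 0₃ 1₃

det : M2 → Seq
det M = (a M *₃ d M) +₃ (-₃ (b M *₃ c M))

_≈_ : M2 → M2 → Set
M ≈ N = (a M ≈₃ a N) × (b M ≈₃ b N) × (c M ≈₃ c N) × (d M ≈₃ d N)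

IsInverse : M2 → M2 → Set
IsInverse M N = IsMat N × (M ⊗ N) ≈ I₂ × (N ⊗ M) ≈ I₂

IsGL : M2 → Set
IsGL M = IsMat M × ∃ λ N → IsInverse M N

IsSL : M2 → Set
IsSL M = IsMat M × det M ≈₃ 1₃

_≡[mod3^_]_ : M2 → ℕ → M2 → Set
M ≡[mod3^ n ] N = (a M n ≡ a N n) × (b M n ≡ b N n) × (c M n ≡ c N n) × (d M n ≡ d N n)

record IsClosedNormalSubgroup (H : M2 → Set) : Set where
  field
    ⊆GL      : ∀ {M} → H M → IsGL M
    resp-≈   : ∀ {M N} → M ≈ N → H M → H N
    has-id   : H I₂
    ∙-closed : ∀ {M N} → H M → H N → H (M ⊗ N)
    ⁻¹-closed : ∀ {M N} → H M → IsInverse M N → H N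
    normal   : ∀ {G G' M} → IsGL G → IsInverse G G' → H M → H ((G ⊗ M) ⊗ G')
    -- closed in the 3-adic topology: H contains every g ∈ GL₂(ℤ₃)
    -- that is a limit of elements of H
    closed   : ∀ {G} → IsGL G → (∀ n → ∃ λ M → H M × M ≡[mod3^ n ] G) → H G

record M3 : Set where
  constructor mat3
  field
    e11 e12 e21 e22 : ℕ
open M3 public

m3 : ℕ → ℕ
m3 x = x % 3

_·₃_ : M3 → M3 → M3
M ·₃ N = mat3 (m3 (e11 M * e11 N + e12 M * e21 N)) (m3 (e11 M * e12 N + e12 M * e22 N))
              (m3 (e21 M * e11 N + e22 M * e21 N)) (m3 (e21 M * e12 N + e22 M * e22 N))

IsSL𝔽₃ : M3 → Set
IsSL𝔽₃ M = (e11 M < 3) × (e12 M < 3) × (e21 M < 3) × (e22 M < 3)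
          × m3 (e11 M * e22 M + 2 * (e12 M * e21 M)) ≡ 1

-- inverse of an SL₂(𝔽₃) matrix: (a b; c d)⁻¹ = (d -b; -c a)
invSL : M3 → M3
invSL M = mat3 (e22 M) (m3 (2 * e12 M)) (m3 (2 * e21 M)) (e11 M)

commutator : M3 → M3 → M3
commutator X Y = ((X ·₃ Y) ·₃ invSL X) ·₃ invSL Y

-- the commutator subgroup [SL₂(𝔽₃), SL₂(𝔽₃)]: generated by commutators
-- (closure under products suffices, the group being finite)
data InCommSL𝔽₃ : M3 → Set where
  gen  : ∀ {X Y} → IsSL𝔽₃ X → IsSL𝔽₃ Y → InCommSL𝔽₃ (commutator X Y)
  prod : ∀ {X Y} → InCommSL𝔽₃ X → InCommSL𝔽₃ Y → InCommSL𝔽₃ (X ·₃ Y)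

red3 : M2 → M3
red3 M = mat3 (a M 1) (b M 1) (c M 1) (d M 1)

-- kernel of φ₃ : GL₂(ℤ₃) → GL₂(𝔽₃)/[SL₂(𝔽₃),SL₂(𝔽₃)] ≅ 𝔖₃
InKerφ₃ : M2 → Set
InKerφ₃ M = InCommSL𝔽₃ (red3 M)

-- Write N = H ∩ SL₂(ℤ₃). Since H is closed, it suffices that N maps onto SL₂(ℤ/3ⁿ) for every n.
-- For n = 1: the commutators [g, h] with g ∈ GL₂(ℤ) lie in N, and since the image of h in GL₂(𝔽₃)
-- avoids [SL₂(𝔽₃), SL₂(𝔽₃)] ≅ Q₈, some product of at most three of them reduces to u = (1 1; 0 1);
-- u and its conjugate by w = (0 -1; 1 0) generate SL₂(𝔽₃). From 3ⁿ to 3ⁿ⁺¹: if Y ∈ N reduces to T modulo 3ⁿ, then K = adj(Y) T is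
-- ≡ 1 + 3ⁿA modulo 3ⁿ⁺¹ with tr A ≡ 0 (mod 3), because det K ≡ 1. Every such K is realised in N:
-- modulo 3ⁿ⁺¹ one has (1 + 3ⁿA)(1 + 3ⁿB) ≡ 1 + 3ⁿ(A + B) and [1 + 3ⁿE₁₂, x] ≡ 1 + 3ⁿ(E₁₂ − x̄E₁₂x̄⁻¹),
-- and the matrices E₁₂ − x̄E₁₂x̄⁻¹ for x̄ = l, l², w (l = (1 0; 1 1)) span the traceless matrices over 𝔽₃.
module Submission where

open import Defs
open import Data.Empty using (⊥-elim)
open import Data.Integer using (ℤ; +_; -[1+_]; _+_; _*_; -_; _-_; NonZero; _%ℕ_; _/ℕ_)
import Data.Integer.DivMod as ℤ
import Data.Integer.Properties as ℤ
open import Data.Integer.Tactic.RingSolver using (solve)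
open import Data.List using (List; []; _∷_; map; concatMap; foldr; filter; cartesianProduct)
open import Data.List.Membership.Propositional using (_∈_; find)
open import Data.List.Membership.Propositional.Properties
  using (∈-map⁻; ∈-concatMap⁻; ∈-filter⁻; ∈-cartesianProduct⁻)
open import Data.List.Relation.Unary.All as All using (All)
open import Data.List.Relation.Unary.Any using (Any; here; there; any?)
open import Data.Nat using (ℕ; zero; suc; z≤n; s≤s)
import Data.Nat as ℕ
import Data.Nat.DivMod as ℕ
import Data.Nat.Properties as ℕ
open import Data.Product using (_×_; _,_; Σ; ∃; proj₁; proj₂)
open import Data.Sum using (_⊎_; inj₁; inj₂)
open import Relation.Binary.Bundles using (Setoid)
open import Relation.Binary.Definitions using (DecidableEquality)
open import Relation.Binary.PropositionalEquality
import Relation.Binary.Reasoning.Setoid as SetoidReasoning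
open import Relation.Nullary using (Dec; ¬_)
open import Relation.Nullary.Decidable using (map′; _×-dec_; _⊎-dec_; _→-dec_; toWitness)
open import Relation.Unary using (Decidable)

infix 4 _≡_[mod_]
infixr 4 _,_
record _≡_[mod_] (x y m : ℤ) : Set where
  constructor _,_
  field
    quotient   : ℤ
    difference : x - y ≡ quotient * m

module _ {m : ℤ} where
  open ≡-Reasoning

  mod-refl : ∀ {x} → x ≡ x [mod m ]
  mod-refl {x} = + 0 , solve (x ∷ m ∷ [])

  mod-reflexive : ∀ {x y} → x ≡ y → x ≡ y [mod m ]
  mod-reflexive refl = mod-refl

  mod-sym : ∀ {x y} → x ≡ y [mod m ] → y ≡ x [mod m ]
  mod-sym {x} {y} (k , e) = - k , (begin
    y - x     ≡⟨ solve (x ∷ y ∷ []) ⟩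
    - (x - y) ≡⟨ cong -_ e ⟩
    - (k * m) ≡⟨ solve (k ∷ m ∷ []) ⟩
    - k * m   ∎)

  mod-trans : ∀ {x y z} → x ≡ y [mod m ] → y ≡ z [mod m ] → x ≡ z [mod m ]
  mod-trans {x} {y} {z} (k , e) (l , f) = k + l , (begin
    x - z             ≡⟨ solve (x ∷ y ∷ z ∷ []) ⟩
    (x - y) + (y - z) ≡⟨ cong₂ _+_ e f ⟩
    k * m + l * m     ≡⟨ solve (k ∷ l ∷ m ∷ []) ⟩
    (k + l) * m       ∎)

  +-cong-mod : ∀ {x y u v} → x ≡ y [mod m ] → u ≡ v [mod m ] → x + u ≡ y + v [mod m ]
  +-cong-mod {x} {y} {u} {v} (k , e) (l , f) = k + l , (begin
    x + u - (y + v)   ≡⟨ solve (x ∷ y ∷ u ∷ v ∷ []) ⟩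
    (x - y) + (u - v) ≡⟨ cong₂ _+_ e f ⟩
    k * m + l * m     ≡⟨ solve (k ∷ l ∷ m ∷ []) ⟩
    (k + l) * m       ∎)

  neg-cong-mod : ∀ {x y} → x ≡ y [mod m ] → - x ≡ - y [mod m ]
  neg-cong-mod {x} {y} (k , e) = - k , (begin
    - x - - y ≡⟨ solve (x ∷ y ∷ []) ⟩
    - (x - y) ≡⟨ cong -_ e ⟩
    - (k * m) ≡⟨ solve (k ∷ m ∷ []) ⟩
    - k * m   ∎)

  sub-cong-mod : ∀ {x y u v} → x ≡ y [mod m ] → u ≡ v [mod m ] → x - u ≡ y - v [mod m ]
  sub-cong-mod p q = +-cong-mod p (neg-cong-mod q)

  *-cong-mod : ∀ {x y u v} → x ≡ y [mod m ] → u ≡ v [mod m ] → x * u ≡ y * v [mod m ]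
  *-cong-mod {x} {y} {u} {v} (k , e) (l , f) = k * u + y * l , (begin
    x * u - y * v             ≡⟨ solve (x ∷ y ∷ u ∷ v ∷ []) ⟩
    (x - y) * u + y * (u - v) ≡⟨ cong₂ (λ p q → p * u + y * q) e f ⟩
    k * m * u + y * (l * m)   ≡⟨ solve (k ∷ l ∷ m ∷ y ∷ u ∷ []) ⟩
    (k * u + y * l) * m       ∎)

  multiple≡0-mod : ∀ k → k * m ≡ + 0 [mod m ]
  multiple≡0-mod k = k , solve (k ∷ m ∷ [])

mod-one : ∀ x y → x ≡ y [mod + 1 ]
mod-one x y = x - y , sym (ℤ.*-identityʳ (x - y))

mod-resp-modulus : ∀ {x y m m′} → m ≡ m′ → x ≡ y [mod m ] → x ≡ y [mod m′ ]
mod-resp-modulus refl x≡y = x≡y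

mod-weaken : ∀ {x y m} l → x ≡ y [mod m * l ] → x ≡ y [mod m ]
mod-weaken {m = m} l (k , e) = k * l , trans e (solve (k ∷ m ∷ l ∷ []))

*-scaleˡ-mod : ∀ {x y m} c → x ≡ y [mod m ] → c * x ≡ c * y [mod c * m ]
*-scaleˡ-mod {x} {y} {m} c (k , e) = k , (begin
  c * x - c * y ≡⟨ solve (x ∷ y ∷ c ∷ []) ⟩
  c * (x - y)   ≡⟨ cong (c *_) e ⟩
  c * (k * m)   ≡⟨ solve (k ∷ m ∷ c ∷ []) ⟩
  k * (c * m)   ∎)
  where open ≡-Reasoning

*-cancelˡ-mod : ∀ {x y m} t .{{_ : NonZero t}} → t * x ≡ t * y [mod t * m ] → x ≡ y [mod m ]
*-cancelˡ-mod {x} {y} {m} t (k , e) = k , ℤ.*-cancelˡ-≡ t (x - y) (k * m) (begin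
  t * (x - y)   ≡⟨ solve (t ∷ x ∷ y ∷ []) ⟩
  t * x - t * y ≡⟨ e ⟩
  k * (t * m)   ≡⟨ solve (k ∷ t ∷ m ∷ []) ⟩
  t * (k * m)   ∎)
  where open ≡-Reasoning

mod-setoid : ℤ → Setoid _ _
mod-setoid m = record
  { Carrier = ℤ
  ; _≈_ = _≡_[mod m ]
  ; isEquivalence = record { refl = mod-refl ; sym = mod-sym ; trans = mod-trans }
  }

module mod-Reasoning (m : ℤ) = SetoidReasoning (mod-setoid m)

residue-unique : ∀ {x y} d .{{_ : ℕ.NonZero d}} → x ℕ.< d → y ℕ.< d → + x ≡ + y [mod + d ] → x ≡ y
residue-unique {x} {y} d x<d y<d (q , x-y≡qd) = by-sign q x-y≡qd
  where
  open ≡-Reasoning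
  shift : ∀ {u v} k → + u - + v ≡ + k * + d → u ≡ v ℕ.+ k ℕ.* d
  shift {u} {v} k e = ℤ.+-injective (begin
    + u                   ≡⟨ split (+ u) (+ v) ⟩
    + v + (+ u - + v)     ≡⟨ cong (_+_ (+ v)) e ⟩
    + v + + k * + d       ≡˘⟨ cong (_+_ (+ v)) (ℤ.pos-* k d) ⟩
    + v + + (k ℕ.* d)     ≡˘⟨ ℤ.pos-+ v (k ℕ.* d) ⟩
    + (v ℕ.+ k ℕ.* d)     ∎)
    where
    split : ∀ u v → u ≡ v + (u - v)
    split u v = solve (u ∷ v ∷ [])
  same-residue : ∀ {u v k} → u ℕ.< d → v ℕ.< d → u ≡ v ℕ.+ k ℕ.* d → u ≡ v
  same-residue {u} {v} {k} u<d v<d u≡v+kd = begin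
    u                     ≡˘⟨ ℕ.m<n⇒m%n≡m u<d ⟩
    u ℕ.% d               ≡⟨ cong (ℕ._% d) u≡v+kd ⟩
    (v ℕ.+ k ℕ.* d) ℕ.% d ≡⟨ ℕ.[m+kn]%n≡m%n v k d ⟩
    v ℕ.% d               ≡⟨ ℕ.m<n⇒m%n≡m v<d ⟩
    v                     ∎
  flip : ∀ u v → v - u ≡ - (u - v)
  flip u v = solve (u ∷ v ∷ [])
  by-sign : ∀ q → + x - + y ≡ q * + d → x ≡ y
  by-sign (+ k)    e = same-residue {k = k} x<d y<d (shift k e)
  by-sign -[1+ k ] e = sym (same-residue {k = suc k} y<d x<d (shift {y} {x} (suc k)
    (trans (flip (+ x) (+ y)) (trans (cong -_ e) (ℤ.neg-distribˡ-* -[1+ k ] (+ d))))))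

record ℤMat : Set where
  constructor ℤmat
  field
    m₁₁ m₁₂ m₂₁ m₂₂ : ℤ
open ℤMat

infixl 6 _⊕_ _⊖_
infixl 7 _·_
infixr 8 _⋆_

_·_ : ℤMat → ℤMat → ℤMat
A · B = ℤmat (m₁₁ A * m₁₁ B + m₁₂ A * m₂₁ B) (m₁₁ A * m₁₂ B + m₁₂ A * m₂₂ B)
             (m₂₁ A * m₁₁ B + m₂₂ A * m₂₁ B) (m₂₁ A * m₁₂ B + m₂₂ A * m₂₂ B)

_⊕_ : ℤMat → ℤMat → ℤMat
A ⊕ B = ℤmat (m₁₁ A + m₁₁ B) (m₁₂ A + m₁₂ B) (m₂₁ A + m₂₁ B) (m₂₂ A + m₂₂ B)

_⊖_ : ℤMat → ℤMat → ℤMat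
A ⊖ B = ℤmat (m₁₁ A - m₁₁ B) (m₁₂ A - m₁₂ B) (m₂₁ A - m₂₁ B) (m₂₂ A - m₂₂ B)

_⋆_ : ℤ → ℤMat → ℤMat
k ⋆ A = ℤmat (k * m₁₁ A) (k * m₁₂ A) (k * m₂₁ A) (k * m₂₂ A)

1ᴹ 0ᴹ E₁₂ : ℤMat
1ᴹ  = ℤmat (+ 1) (+ 0) (+ 0) (+ 1)
0ᴹ  = ℤmat (+ 0) (+ 0) (+ 0) (+ 0)
E₁₂ = ℤmat (+ 0) (+ 1) (+ 0) (+ 0)

determinant : ℤMat → ℤ
determinant A = m₁₁ A * m₂₂ A - m₁₂ A * m₂₁ A

trace : ℤMat → ℤ
trace A = m₁₁ A + m₂₂ A

adjugate : ℤMat → ℤMat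
adjugate A = ℤmat (m₂₂ A) (- m₁₂ A) (- m₂₁ A) (m₁₁ A)

ℤmat-cong : ∀ {x₁ x₂ x₃ x₄ y₁ y₂ y₃ y₄} → x₁ ≡ y₁ → x₂ ≡ y₂ → x₃ ≡ y₃ → x₄ ≡ y₄ →
            ℤmat x₁ x₂ x₃ x₄ ≡ ℤmat y₁ y₂ y₃ y₄
ℤmat-cong refl refl refl refl = refl

·-assoc : ∀ A B C → A · B · C ≡ A · (B · C)
·-assoc (ℤmat a₁ a₂ a₃ a₄) (ℤmat b₁ b₂ b₃ b₄) (ℤmat c₁ c₂ c₃ c₄) =
  ℤmat-cong (entry a₁ a₂ c₁ c₃) (entry a₁ a₂ c₂ c₄) (entry a₃ a₄ c₁ c₃) (entry a₃ a₄ c₂ c₄)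
  where
  entry : ∀ x₁ x₂ z₁ z₂ → (x₁ * b₁ + x₂ * b₃) * z₁ + (x₁ * b₂ + x₂ * b₄) * z₂
                        ≡ x₁ * (b₁ * z₁ + b₂ * z₂) + x₂ * (b₃ * z₁ + b₄ * z₂)
  entry x₁ x₂ z₁ z₂ = solve (x₁ ∷ x₂ ∷ z₁ ∷ z₂ ∷ b₁ ∷ b₂ ∷ b₃ ∷ b₄ ∷ [])

·-identityˡ : ∀ A → 1ᴹ · A ≡ A
·-identityˡ (ℤmat a₁ a₂ a₃ a₄) =
  ℤmat-cong (first a₁ a₃) (first a₂ a₄) (second a₁ a₃) (second a₂ a₄)
  where
  first : ∀ x y → + 1 * x + + 0 * y ≡ x
  first x y = solve (x ∷ y ∷ [])
  second : ∀ x y → + 0 * x + + 1 * y ≡ y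
  second x y = solve (x ∷ y ∷ [])

·-identityʳ : ∀ A → A · 1ᴹ ≡ A
·-identityʳ (ℤmat a₁ a₂ a₃ a₄) =
  ℤmat-cong (first a₁ a₂) (second a₁ a₂) (first a₃ a₄) (second a₃ a₄)
  where
  first : ∀ x y → x * + 1 + y * + 0 ≡ x
  first x y = solve (x ∷ y ∷ [])
  second : ∀ x y → x * + 0 + y * + 1 ≡ y
  second x y = solve (x ∷ y ∷ [])

⋆-identity : ∀ A → (+ 1) ⋆ A ≡ A
⋆-identity (ℤmat a₁ a₂ a₃ a₄) =
  ℤmat-cong (ℤ.*-identityˡ a₁) (ℤ.*-identityˡ a₂) (ℤ.*-identityˡ a₃) (ℤ.*-identityˡ a₄)

⋆-zeroʳ : ∀ t → t ⋆ 0ᴹ ≡ 0ᴹ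
⋆-zeroʳ t = ℤmat-cong (ℤ.*-zeroʳ t) (ℤ.*-zeroʳ t) (ℤ.*-zeroʳ t) (ℤ.*-zeroʳ t)

⋆-suc : ∀ e A → (+ e) ⋆ A ⊕ A ≡ (+ suc e) ⋆ A
⋆-suc e (ℤmat a₁ a₂ a₃ a₄) = ℤmat-cong (entry a₁) (entry a₂) (entry a₃) (entry a₄)
  where
  distrib : ∀ u x → u * x + x ≡ (+ 1 + u) * x
  distrib u x = solve (u ∷ x ∷ [])
  entry : ∀ x → + e * x + x ≡ + suc e * x
  entry x = trans (distrib (+ e) x) (cong (_* x) (sym (ℤ.pos-+ 1 e)))

⋆1ᴹ-· : ∀ k A → k ⋆ 1ᴹ · A ≡ k ⋆ A
⋆1ᴹ-· k (ℤmat a₁ a₂ a₃ a₄) =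
  ℤmat-cong (first a₁ a₃) (first a₂ a₄) (second a₁ a₃) (second a₂ a₄)
  where
  first : ∀ x y → k * + 1 * x + k * + 0 * y ≡ k * x
  first x y = solve (k ∷ x ∷ y ∷ [])
  second : ∀ x y → k * + 0 * x + k * + 1 * y ≡ k * y
  second x y = solve (k ∷ x ∷ y ∷ [])

·-adjugate : ∀ A → A · adjugate A ≡ determinant A ⋆ 1ᴹ
·-adjugate (ℤmat a₁ a₂ a₃ a₄) = ℤmat-cong e₁₁ e₁₂ e₂₁ e₂₂
  where
  e₁₁ : a₁ * a₄ + a₂ * - a₃ ≡ (a₁ * a₄ - a₂ * a₃) * + 1
  e₁₁ = solve (a₁ ∷ a₂ ∷ a₃ ∷ a₄ ∷ [])
  e₁₂ : a₁ * - a₂ + a₂ * a₁ ≡ (a₁ * a₄ - a₂ * a₃) * + 0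
  e₁₂ = solve (a₁ ∷ a₂ ∷ a₃ ∷ a₄ ∷ [])
  e₂₁ : a₃ * a₄ + a₄ * - a₃ ≡ (a₁ * a₄ - a₂ * a₃) * + 0
  e₂₁ = solve (a₁ ∷ a₂ ∷ a₃ ∷ a₄ ∷ [])
  e₂₂ : a₃ * - a₂ + a₄ * a₁ ≡ (a₁ * a₄ - a₂ * a₃) * + 1
  e₂₂ = solve (a₁ ∷ a₂ ∷ a₃ ∷ a₄ ∷ [])

adjugate-· : ∀ A → adjugate A · A ≡ determinant A ⋆ 1ᴹ
adjugate-· (ℤmat a₁ a₂ a₃ a₄) = ℤmat-cong e₁₁ e₁₂ e₂₁ e₂₂
  where
  e₁₁ : a₄ * a₁ + - a₂ * a₃ ≡ (a₁ * a₄ - a₂ * a₃) * + 1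
  e₁₁ = solve (a₁ ∷ a₂ ∷ a₃ ∷ a₄ ∷ [])
  e₁₂ : a₄ * a₂ + - a₂ * a₄ ≡ (a₁ * a₄ - a₂ * a₃) * + 0
  e₁₂ = solve (a₁ ∷ a₂ ∷ a₃ ∷ a₄ ∷ [])
  e₂₁ : - a₃ * a₁ + a₁ * a₃ ≡ (a₁ * a₄ - a₂ * a₃) * + 0
  e₂₁ = solve (a₁ ∷ a₂ ∷ a₃ ∷ a₄ ∷ [])
  e₂₂ : - a₃ * a₂ + a₁ * a₄ ≡ (a₁ * a₄ - a₂ * a₃) * + 1
  e₂₂ = solve (a₁ ∷ a₂ ∷ a₃ ∷ a₄ ∷ [])

determinant-· : ∀ A B → determinant (A · B) ≡ determinant A * determinant B
determinant-· (ℤmat a₁ a₂ a₃ a₄) (ℤmat b₁ b₂ b₃ b₄) = expand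
  where
  expand : (a₁ * b₁ + a₂ * b₃) * (a₃ * b₂ + a₄ * b₄) - (a₁ * b₂ + a₂ * b₄) * (a₃ * b₁ + a₄ * b₃)
         ≡ (a₁ * a₄ - a₂ * a₃) * (b₁ * b₄ - b₂ * b₃)
  expand = solve (a₁ ∷ a₂ ∷ a₃ ∷ a₄ ∷ b₁ ∷ b₂ ∷ b₃ ∷ b₄ ∷ [])

determinant-adjugate : ∀ A → determinant (adjugate A) ≡ determinant A
determinant-adjugate (ℤmat a₁ a₂ a₃ a₄) = expand
  where
  expand : a₄ * a₁ - - a₂ * - a₃ ≡ a₁ * a₄ - a₂ * a₃
  expand = solve (a₁ ∷ a₂ ∷ a₃ ∷ a₄ ∷ [])

determinant-conjugate : ∀ G G′ X → G · G′ ≡ 1ᴹ → determinant (G · X · G′) ≡ determinant X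
determinant-conjugate G G′ X GG′≡1 = begin
  determinant (G · X · G′)                       ≡⟨ determinant-· (G · X) G′ ⟩
  determinant (G · X) * determinant G′           ≡⟨ cong (_* determinant G′) (determinant-· G X) ⟩
  determinant G * determinant X * determinant G′ ≡⟨ swap (determinant G) (determinant X) (determinant G′) ⟩
  determinant G * determinant G′ * determinant X ≡˘⟨ cong (_* determinant X) (determinant-· G G′) ⟩
  determinant (G · G′) * determinant X           ≡⟨ cong (λ Z → determinant Z * determinant X) GG′≡1 ⟩
  + 1 * determinant X                            ≡⟨ ℤ.*-identityˡ (determinant X) ⟩
  determinant X                                  ∎
  where
  open ≡-Reasoning
  swap : ∀ x y z → x * y * z ≡ x * z * y
  swap x y z = solve (x ∷ y ∷ z ∷ [])

unipotent-· : ∀ s r A B → (1ᴹ ⊕ s ⋆ A) · (1ᴹ ⊕ r ⋆ B) ≡ 1ᴹ ⊕ s ⋆ A ⊕ r ⋆ B ⊕ (s * r) ⋆ (A · B)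
unipotent-· s r (ℤmat a₁ a₂ a₃ a₄) (ℤmat b₁ b₂ b₃ b₄) = ℤmat-cong e₁₁ e₁₂ e₂₁ e₂₂
  where
  e₁₁ : (+ 1 + s * a₁) * (+ 1 + r * b₁) + (+ 0 + s * a₂) * (+ 0 + r * b₃)
      ≡ + 1 + s * a₁ + r * b₁ + s * r * (a₁ * b₁ + a₂ * b₃)
  e₁₁ = solve (s ∷ r ∷ a₁ ∷ a₂ ∷ b₁ ∷ b₃ ∷ [])
  e₁₂ : (+ 1 + s * a₁) * (+ 0 + r * b₂) + (+ 0 + s * a₂) * (+ 1 + r * b₄)
      ≡ + 0 + s * a₂ + r * b₂ + s * r * (a₁ * b₂ + a₂ * b₄)
  e₁₂ = solve (s ∷ r ∷ a₁ ∷ a₂ ∷ b₂ ∷ b₄ ∷ [])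
  e₂₁ : (+ 0 + s * a₃) * (+ 1 + r * b₁) + (+ 1 + s * a₄) * (+ 0 + r * b₃)
      ≡ + 0 + s * a₃ + r * b₃ + s * r * (a₃ * b₁ + a₄ * b₃)
  e₂₁ = solve (s ∷ r ∷ a₃ ∷ a₄ ∷ b₁ ∷ b₃ ∷ [])
  e₂₂ : (+ 0 + s * a₃) * (+ 0 + r * b₂) + (+ 1 + s * a₄) * (+ 1 + r * b₄)
      ≡ + 1 + s * a₄ + r * b₄ + s * r * (a₃ * b₂ + a₄ * b₄)
  e₂₂ = solve (s ∷ r ∷ a₃ ∷ a₄ ∷ b₂ ∷ b₄ ∷ [])

unipotent-·ˡ : ∀ s A B → (1ᴹ ⊕ s ⋆ A) · B ≡ B ⊕ s ⋆ (A · B)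
unipotent-·ˡ s (ℤmat a₁ a₂ a₃ a₄) (ℤmat b₁ b₂ b₃ b₄) =
  ℤmat-cong (row₁ b₁ b₃) (row₁ b₂ b₄) (row₂ b₁ b₃) (row₂ b₂ b₄)
  where
  row₁ : ∀ y₁ y₂ → (+ 1 + s * a₁) * y₁ + (+ 0 + s * a₂) * y₂ ≡ y₁ + s * (a₁ * y₁ + a₂ * y₂)
  row₁ y₁ y₂ = solve (s ∷ a₁ ∷ a₂ ∷ y₁ ∷ y₂ ∷ [])
  row₂ : ∀ y₁ y₂ → (+ 0 + s * a₃) * y₁ + (+ 1 + s * a₄) * y₂ ≡ y₂ + s * (a₃ * y₁ + a₄ * y₂)
  row₂ y₁ y₂ = solve (s ∷ a₃ ∷ a₄ ∷ y₁ ∷ y₂ ∷ [])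

·-distribˡ-⊕⋆ : ∀ k A B C → A · (B ⊕ k ⋆ C) ≡ A · B ⊕ k ⋆ (A · C)
·-distribˡ-⊕⋆ k (ℤmat a₁ a₂ a₃ a₄) (ℤmat b₁ b₂ b₃ b₄) (ℤmat c₁ c₂ c₃ c₄) =
  ℤmat-cong (entry a₁ a₂ b₁ b₃ c₁ c₃) (entry a₁ a₂ b₂ b₄ c₂ c₄)
            (entry a₃ a₄ b₁ b₃ c₁ c₃) (entry a₃ a₄ b₂ b₄ c₂ c₄)
  where
  entry : ∀ x₁ x₂ y₁ y₂ z₁ z₂ → x₁ * (y₁ + k * z₁) + x₂ * (y₂ + k * z₂)
                              ≡ x₁ * y₁ + x₂ * y₂ + k * (x₁ * z₁ + x₂ * z₂)
  entry x₁ x₂ y₁ y₂ z₁ z₂ = solve (k ∷ x₁ ∷ x₂ ∷ y₁ ∷ y₂ ∷ z₁ ∷ z₂ ∷ [])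

⋆-distribˡ-⊕ : ∀ t C A B → C ⊕ t ⋆ A ⊕ t ⋆ B ≡ C ⊕ t ⋆ (A ⊕ B)
⋆-distribˡ-⊕ t (ℤmat c₁ c₂ c₃ c₄) (ℤmat a₁ a₂ a₃ a₄) (ℤmat b₁ b₂ b₃ b₄) =
  ℤmat-cong (entry c₁ a₁ b₁) (entry c₂ a₂ b₂) (entry c₃ a₃ b₃) (entry c₄ a₄ b₄)
  where
  entry : ∀ z x y → z + t * x + t * y ≡ z + t * (x + y)
  entry z x y = solve (t ∷ z ∷ x ∷ y ∷ [])

⋆-distribˡ-⊖ : ∀ t C A B → C ⊕ t ⋆ A ⊕ (- t) ⋆ B ≡ C ⊕ t ⋆ (A ⊖ B)
⋆-distribˡ-⊖ t (ℤmat c₁ c₂ c₃ c₄) (ℤmat a₁ a₂ a₃ a₄) (ℤmat b₁ b₂ b₃ b₄) =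
  ℤmat-cong (entry c₁ a₁ b₁) (entry c₂ a₂ b₂) (entry c₃ a₃ b₃) (entry c₄ a₄ b₄)
  where
  entry : ∀ z x y → z + t * x + - t * y ≡ z + t * (x - y)
  entry z x y = solve (t ∷ z ∷ x ∷ y ∷ [])

determinant-unipotent : ∀ t A → determinant (1ᴹ ⊕ t ⋆ A) ≡ + 1 + t * trace A + t * t * determinant A
determinant-unipotent t (ℤmat a₁ a₂ a₃ a₄) = expand
  where
  expand : (+ 1 + t * a₁) * (+ 1 + t * a₄) - (+ 0 + t * a₂) * (+ 0 + t * a₃)
         ≡ + 1 + t * (a₁ + a₄) + t * t * (a₁ * a₄ - a₂ * a₃)
  expand = solve (t ∷ a₁ ∷ a₂ ∷ a₃ ∷ a₄ ∷ [])

elementary-inverse : ∀ t → (1ᴹ ⊕ t ⋆ E₁₂) · (1ᴹ ⊕ (- t) ⋆ E₁₂) ≡ 1ᴹ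
elementary-inverse t = ℤmat-cong e₁₁ e₁₂ e₂₁ e₂₂
  where
  e₁₁ : (+ 1 + t * + 0) * (+ 1 + - t * + 0) + (+ 0 + t * + 1) * (+ 0 + - t * + 0) ≡ + 1
  e₁₁ = solve (t ∷ [])
  e₁₂ : (+ 1 + t * + 0) * (+ 0 + - t * + 1) + (+ 0 + t * + 1) * (+ 1 + - t * + 0) ≡ + 0
  e₁₂ = solve (t ∷ [])
  e₂₁ : (+ 0 + t * + 0) * (+ 1 + - t * + 0) + (+ 1 + t * + 0) * (+ 0 + - t * + 0) ≡ + 0
  e₂₁ = solve (t ∷ [])
  e₂₂ : (+ 0 + t * + 0) * (+ 0 + - t * + 1) + (+ 1 + t * + 0) * (+ 1 + - t * + 0) ≡ + 1
  e₂₂ = solve (t ∷ [])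

infix 4 _≡ᴹ_[mod_]
record _≡ᴹ_[mod_] (A B : ℤMat) (m : ℤ) : Set where
  constructor entrywise
  field
    ₁₁ : m₁₁ A ≡ m₁₁ B [mod m ]
    ₁₂ : m₁₂ A ≡ m₁₂ B [mod m ]
    ₂₁ : m₂₁ A ≡ m₂₁ B [mod m ]
    ₂₂ : m₂₂ A ≡ m₂₂ B [mod m ]

module _ {m : ℤ} where

  ≡ᴹ-refl : ∀ {A} → A ≡ᴹ A [mod m ]
  ≡ᴹ-refl = entrywise mod-refl mod-refl mod-refl mod-refl

  ≡ᴹ-reflexive : ∀ {A B} → A ≡ B → A ≡ᴹ B [mod m ]
  ≡ᴹ-reflexive refl = ≡ᴹ-refl

  ≡ᴹ-sym : ∀ {A B} → A ≡ᴹ B [mod m ] → B ≡ᴹ A [mod m ]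
  ≡ᴹ-sym (entrywise p q r s) = entrywise (mod-sym p) (mod-sym q) (mod-sym r) (mod-sym s)

  ≡ᴹ-trans : ∀ {A B C} → A ≡ᴹ B [mod m ] → B ≡ᴹ C [mod m ] → A ≡ᴹ C [mod m ]
  ≡ᴹ-trans (entrywise p q r s) (entrywise p′ q′ r′ s′) =
    entrywise (mod-trans p p′) (mod-trans q q′) (mod-trans r r′) (mod-trans s s′)

  ·-cong-mod : ∀ {A B C D} → A ≡ᴹ B [mod m ] → C ≡ᴹ D [mod m ] → A · C ≡ᴹ B · D [mod m ]
  ·-cong-mod (entrywise p q r s) (entrywise p′ q′ r′ s′) = entrywise
    (+-cong-mod (*-cong-mod p p′) (*-cong-mod q r′)) (+-cong-mod (*-cong-mod p q′) (*-cong-mod q s′))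
    (+-cong-mod (*-cong-mod r p′) (*-cong-mod s r′)) (+-cong-mod (*-cong-mod r q′) (*-cong-mod s s′))

  ⊕-cong-mod : ∀ {A B C D} → A ≡ᴹ B [mod m ] → C ≡ᴹ D [mod m ] → A ⊕ C ≡ᴹ B ⊕ D [mod m ]
  ⊕-cong-mod (entrywise p q r s) (entrywise p′ q′ r′ s′) =
    entrywise (+-cong-mod p p′) (+-cong-mod q q′) (+-cong-mod r r′) (+-cong-mod s s′)

  ⊖-cong-mod : ∀ {A B C D} → A ≡ᴹ B [mod m ] → C ≡ᴹ D [mod m ] → A ⊖ C ≡ᴹ B ⊖ D [mod m ]
  ⊖-cong-mod (entrywise p q r s) (entrywise p′ q′ r′ s′) =
    entrywise (sub-cong-mod p p′) (sub-cong-mod q q′) (sub-cong-mod r r′) (sub-cong-mod s s′)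

  ⋆-cong-mod : ∀ {k l A B} → k ≡ l [mod m ] → A ≡ᴹ B [mod m ] → k ⋆ A ≡ᴹ l ⋆ B [mod m ]
  ⋆-cong-mod e (entrywise p q r s) =
    entrywise (*-cong-mod e p) (*-cong-mod e q) (*-cong-mod e r) (*-cong-mod e s)

  determinant-cong-mod : ∀ {A B} → A ≡ᴹ B [mod m ] → determinant A ≡ determinant B [mod m ]
  determinant-cong-mod (entrywise p q r s) = sub-cong-mod (*-cong-mod p s) (*-cong-mod q r)

  ⋆-negligible : ∀ {k} A → k ≡ + 0 [mod m ] → k ⋆ A ≡ᴹ 0ᴹ [mod m ]
  ⋆-negligible {k} (ℤmat a₁ a₂ a₃ a₄) k≡0 = entrywise (vanish a₁) (vanish a₂) (vanish a₃) (vanish a₄)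
    where
    vanish : ∀ x → k * x ≡ + 0 [mod m ]
    vanish x = mod-trans (*-cong-mod k≡0 mod-refl) (mod-reflexive (ℤ.*-zeroˡ x))

  ⊕-negligible : ∀ {A B} → B ≡ᴹ 0ᴹ [mod m ] → A ⊕ B ≡ᴹ A [mod m ]
  ⊕-negligible {A} B≡0 = ≡ᴹ-trans (⊕-cong-mod (≡ᴹ-refl {A = A}) B≡0) (≡ᴹ-reflexive (ℤmat-cong
    (ℤ.+-identityʳ (m₁₁ A)) (ℤ.+-identityʳ (m₁₂ A)) (ℤ.+-identityʳ (m₂₁ A)) (ℤ.+-identityʳ (m₂₂ A))))

  ⋆-≡1 : ∀ {k} A → k ≡ + 1 [mod m ] → k ⋆ A ≡ᴹ A [mod m ]
  ⋆-≡1 A k≡1 = ≡ᴹ-trans (⋆-cong-mod k≡1 (≡ᴹ-refl {A = A})) (≡ᴹ-reflexive (⋆-identity A))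

  ≡ᴹ-setoid : Setoid _ _
  ≡ᴹ-setoid = record
    { Carrier = ℤMat
    ; _≈_ = _≡ᴹ_[mod m ]
    ; isEquivalence = record { refl = ≡ᴹ-refl ; sym = ≡ᴹ-sym ; trans = ≡ᴹ-trans }
    }

module ≡ᴹ-Reasoning (m : ℤ) = SetoidReasoning (≡ᴹ-setoid {m})

≡ᴹ-resp-modulus : ∀ {A B m m′} → m ≡ m′ → A ≡ᴹ B [mod m ] → A ≡ᴹ B [mod m′ ]
≡ᴹ-resp-modulus refl A≡B = A≡B

⋆-scale-mod : ∀ {A B m} k → A ≡ᴹ B [mod m ] → k ⋆ A ≡ᴹ k ⋆ B [mod k * m ]
⋆-scale-mod k (entrywise p q r s) =
  entrywise (*-scaleˡ-mod k p) (*-scaleˡ-mod k q) (*-scaleˡ-mod k r) (*-scaleˡ-mod k s)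

left-inverse-unique : ∀ {A A′ A″ m} →
  A′ · A ≡ᴹ 1ᴹ [mod m ] → A · A″ ≡ᴹ 1ᴹ [mod m ] → A′ ≡ᴹ A″ [mod m ]
left-inverse-unique {A} {A′} {A″} {m} left right = begin
  A′             ≡˘⟨ ·-identityʳ A′ ⟩
  A′ · 1ᴹ        ≈˘⟨ ·-cong-mod (≡ᴹ-refl {A = A′}) right ⟩
  A′ · (A · A″)  ≡˘⟨ ·-assoc A′ A A″ ⟩
  A′ · A · A″    ≈⟨ ·-cong-mod left (≡ᴹ-refl {A = A″}) ⟩
  1ᴹ · A″        ≡⟨ ·-identityˡ A″ ⟩
  A″             ∎
  where open ≡ᴹ-Reasoning m

unipotent-decomposition : ∀ {K t} → K ≡ᴹ 1ᴹ [mod t ] → Σ ℤMat λ A → K ≡ 1ᴹ ⊕ t ⋆ A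
unipotent-decomposition {t = t} (entrywise (q₁ , e₁) (q₂ , e₂) (q₃ , e₃) (q₄ , e₄)) =
  ℤmat q₁ q₂ q₃ q₄ ,
  ℤmat-cong (shift (+ 1) q₁ e₁) (shift (+ 0) q₂ e₂) (shift (+ 0) q₃ e₃) (shift (+ 1) q₄ e₄)
  where
  split : ∀ x y → x ≡ y + (x - y)
  split x y = solve (x ∷ y ∷ [])
  shift : ∀ {x} y q → x - y ≡ q * t → x ≡ y + t * q
  shift {x} y q e = trans (split x y) (cong (_+_ y) (trans e (ℤ.*-comm q t)))

module _ {m : ℤ} {Y : ℤMat} (det-Y≡1 : determinant Y ≡ + 1 [mod m ]) where

  adjugate-correction : ∀ T → Y · (adjugate Y · T) ≡ᴹ T [mod m ]
  adjugate-correction T = begin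
    Y · (adjugate Y · T)   ≡˘⟨ ·-assoc Y (adjugate Y) T ⟩
    Y · adjugate Y · T     ≡⟨ cong (_· T) (·-adjugate Y) ⟩
    determinant Y ⋆ 1ᴹ · T ≡⟨ ⋆1ᴹ-· (determinant Y) T ⟩
    determinant Y ⋆ T      ≈⟨ ⋆-≡1 T det-Y≡1 ⟩
    T                      ∎
    where open ≡ᴹ-Reasoning m

  adjugate-·-≡1 : ∀ {T} → Y ≡ᴹ T [mod m ] → adjugate Y · T ≡ᴹ 1ᴹ [mod m ]
  adjugate-·-≡1 {T} Y≡T = begin
    adjugate Y · T     ≈˘⟨ ·-cong-mod (≡ᴹ-refl {A = adjugate Y}) Y≡T ⟩
    adjugate Y · Y     ≡⟨ adjugate-· Y ⟩
    determinant Y ⋆ 1ᴹ ≈⟨ ⋆-≡1 1ᴹ det-Y≡1 ⟩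
    1ᴹ                 ∎
    where open ≡ᴹ-Reasoning m

  determinant-adjugate-·-≡1 : ∀ {T} → determinant T ≡ + 1 [mod m ] →
                              determinant (adjugate Y · T) ≡ + 1 [mod m ]
  determinant-adjugate-·-≡1 {T} det-T≡1 = begin
    determinant (adjugate Y · T)             ≡⟨ determinant-· (adjugate Y) T ⟩
    determinant (adjugate Y) * determinant T ≡⟨ cong (_* determinant T) (determinant-adjugate Y) ⟩
    determinant Y * determinant T            ≈⟨ *-cong-mod det-Y≡1 det-T≡1 ⟩
    + 1                                      ∎
    where open mod-Reasoning m

module _ {t m : ℤ} (t²≡0 : t * t ≡ + 0 [mod m ]) where

  unipotent-·-mod : ∀ A B → (1ᴹ ⊕ t ⋆ A) · (1ᴹ ⊕ t ⋆ B) ≡ᴹ 1ᴹ ⊕ t ⋆ (A ⊕ B) [mod m ]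
  unipotent-·-mod A B = begin
    (1ᴹ ⊕ t ⋆ A) · (1ᴹ ⊕ t ⋆ B)            ≡⟨ unipotent-· t t A B ⟩
    1ᴹ ⊕ t ⋆ A ⊕ t ⋆ B ⊕ (t * t) ⋆ (A · B) ≈⟨ ⊕-negligible (⋆-negligible (A · B) t²≡0) ⟩
    1ᴹ ⊕ t ⋆ A ⊕ t ⋆ B                     ≡⟨ ⋆-distribˡ-⊕ t 1ᴹ A B ⟩
    1ᴹ ⊕ t ⋆ (A ⊕ B)                       ∎
    where open ≡ᴹ-Reasoning m

  unipotent-commutator-mod : ∀ A X Y → X · Y ≡ᴹ 1ᴹ [mod m ] →
    (1ᴹ ⊕ t ⋆ A) · X · (1ᴹ ⊕ (- t) ⋆ A) · Y ≡ᴹ 1ᴹ ⊕ t ⋆ (A ⊖ X · (A · Y)) [mod m ]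
  unipotent-commutator-mod A X Y XY≡1 = begin
    G · X · G⁻ · Y
      ≡⟨ trans (·-assoc (G · X) G⁻ Y) (·-assoc G X (G⁻ · Y)) ⟩
    G · (X · (G⁻ · Y))
      ≡⟨ cong (λ Z → G · (X · Z)) (unipotent-·ˡ (- t) A Y) ⟩
    G · (X · (Y ⊕ (- t) ⋆ (A · Y)))
      ≡⟨ cong (G ·_) (·-distribˡ-⊕⋆ (- t) X Y (A · Y)) ⟩
    G · (X · Y ⊕ (- t) ⋆ D)
      ≈⟨ ·-cong-mod (≡ᴹ-refl {A = G}) (⊕-cong-mod XY≡1 (≡ᴹ-refl {A = (- t) ⋆ D})) ⟩
    G · (1ᴹ ⊕ (- t) ⋆ D)
      ≡⟨ unipotent-· t (- t) A D ⟩
    1ᴹ ⊕ t ⋆ A ⊕ (- t) ⋆ D ⊕ (t * - t) ⋆ (A · D)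
      ≈⟨ ⊕-negligible (⋆-negligible (A · D) t*-t≡0) ⟩
    1ᴹ ⊕ t ⋆ A ⊕ (- t) ⋆ D
      ≡⟨ ⋆-distribˡ-⊖ t 1ᴹ A D ⟩
    1ᴹ ⊕ t ⋆ (A ⊖ D) ∎
    where
    open ≡ᴹ-Reasoning m
    G G⁻ D : ℤMat
    G = 1ᴹ ⊕ t ⋆ A
    G⁻ = 1ᴹ ⊕ (- t) ⋆ A
    D = X · (A · Y)
    t*-t≡0 : t * - t ≡ + 0 [mod m ]
    t*-t≡0 = mod-trans (mod-reflexive (sym (ℤ.neg-distribʳ-* t t))) (neg-cong-mod t²≡0)

  scaled-trace≡0 : ∀ A → determinant (1ᴹ ⊕ t ⋆ A) ≡ + 1 [mod m ] → t * trace A ≡ + 0 [mod m ]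
  scaled-trace≡0 A det≡1 = begin
    t * trace A
      ≡⟨ isolate (trace A) δ ⟩
    (+ 1 + t * trace A + t * t * δ) - + 1 - t * t * δ
      ≡˘⟨ cong (λ z → z - + 1 - t * t * δ) (determinant-unipotent t A) ⟩
    determinant (1ᴹ ⊕ t ⋆ A) - + 1 - t * t * δ
      ≈⟨ sub-cong-mod (sub-cong-mod det≡1 mod-refl) (*-cong-mod t²≡0 mod-refl) ⟩
    + 1 - + 1 - + 0 * δ
      ≡⟨ cancel δ ⟩
    + 0 ∎
    where
    open mod-Reasoning m
    δ : ℤ
    δ = determinant A
    isolate : ∀ u v → t * u ≡ (+ 1 + t * u + t * t * v) - + 1 - t * t * v
    isolate u v = solve (t ∷ u ∷ v ∷ [])
    cancel : ∀ v → + 1 - + 1 - + 0 * v ≡ + 0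
    cancel v = solve (v ∷ [])

-- Levels of 3-adic matrices

3^_ : ℕ → ℤ
3^ n = + (3 ℕ.^ n)

3^-nonZero : ∀ n → ℕ.NonZero (3 ℕ.^ n)
3^-nonZero n = ℕ.m^n≢0 3 n

3^-suc : ∀ n → 3^ suc n ≡ 3^ n * + 3
3^-suc n = trans (ℤ.pos-* 3 (3 ℕ.^ n)) (ℤ.*-comm (+ 3) (3^ n))

3^-sucˡ : ∀ n → 3^ suc n ≡ + 3 * 3^ n
3^-sucˡ n = ℤ.pos-* 3 (3 ℕ.^ n)

residue-unique₃ : ∀ n {x y} → x ℕ.< 3 ℕ.^ n → y ℕ.< 3 ℕ.^ n → + x ≡ + y [mod 3^ n ] → x ≡ y
residue-unique₃ n = residue-unique (3 ℕ.^ n) {{3^-nonZero n}}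

constantSeq : ℤ → Seq
constantSeq z n = _%ℕ_ z (3 ℕ.^ n) {{3^-nonZero n}}

constantSeq-mod : ∀ z n → + constantSeq z n ≡ z [mod 3^ n ]
constantSeq-mod z n = - q , (begin
  + r - z                ≡⟨ cong (_-_ (+ r)) (ℤ.a≡a%ℕn+[a/ℕn]*n z (3 ℕ.^ n)) ⟩
  + r - (+ r + q * 3^ n) ≡⟨ cancel (+ r) q (3^ n) ⟩
  - q * 3^ n             ∎)
  where
  open ≡-Reasoning
  instance _ = 3^-nonZero n
  r : ℕ
  r = constantSeq z n
  q : ℤ
  q = z /ℕ 3 ℕ.^ n
  cancel : ∀ r q m → r - (r + q * m) ≡ - q * m
  cancel r q m = solve (r ∷ q ∷ m ∷ [])

md-mod : ∀ n v → + md n v ≡ + v [mod 3^ n ]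
md-mod n v = constantSeq-mod (+ v) n

md< : ∀ n v → md n v ℕ.< 3 ℕ.^ n
md< n v = ℕ.m%n<n v (3 ℕ.^ n) {{3^-nonZero n}}

+₃-mod : ∀ n x y {u v} → + x n ≡ u [mod 3^ n ] → + y n ≡ v [mod 3^ n ] →
         + (x +₃ y) n ≡ u + v [mod 3^ n ]
+₃-mod n x y x≡u y≡v = mod-trans (md-mod n (x n ℕ.+ y n))
  (mod-trans (mod-reflexive (ℤ.pos-+ (x n) (y n))) (+-cong-mod x≡u y≡v))

*₃-mod : ∀ n x y {u v} → + x n ≡ u [mod 3^ n ] → + y n ≡ v [mod 3^ n ] →
         + (x *₃ y) n ≡ u * v [mod 3^ n ]
*₃-mod n x y x≡u y≡v = mod-trans (md-mod n (x n ℕ.* y n))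
  (mod-trans (mod-reflexive (ℤ.pos-* (x n) (y n))) (*-cong-mod x≡u y≡v))

-₃-mod : ∀ n x {u} → x n ℕ.≤ 3 ℕ.^ n → + x n ≡ u [mod 3^ n ] → + (-₃ x) n ≡ - u [mod 3^ n ]
-₃-mod n x {u} x≤3ⁿ x≡u = mod-trans (md-mod n (3 ℕ.^ n ℕ.∸ x n))
  (mod-trans (mod-reflexive ∸-as-sub)
    (mod-trans (sub-cong-mod (multiple≡0-mod (+ 1)) x≡u) (mod-reflexive (ℤ.+-identityˡ (- u)))))
  where
  ∸-as-sub : + (3 ℕ.^ n ℕ.∸ x n) ≡ + 1 * 3^ n - + x n
  ∸-as-sub = sym (trans (cong (_- + x n) (ℤ.*-identityˡ (3^ n)))
                        (trans (ℤ.m-n≡m⊖n (3 ℕ.^ n) (x n)) (ℤ.⊖-≥ x≤3ⁿ)))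

level : ℕ → M2 → ℤMat
level n M = ℤmat (+ a M n) (+ b M n) (+ c M n) (+ d M n)

level-⊗ : ∀ n M N → level n (M ⊗ N) ≡ᴹ level n M · level n N [mod 3^ n ]
level-⊗ n M N = entrywise (entry (a M) (a N) (b M) (c N)) (entry (a M) (b N) (b M) (d N))
                          (entry (c M) (a N) (d M) (c N)) (entry (c M) (b N) (d M) (d N))
  where
  entry : ∀ x₁ y₁ x₂ y₂ → + ((x₁ *₃ y₁) +₃ (x₂ *₃ y₂)) n ≡ + x₁ n * + y₁ n + + x₂ n * + y₂ n [mod 3^ n ]
  entry x₁ y₁ x₂ y₂ = +₃-mod n (x₁ *₃ y₁) (x₂ *₃ y₂)
    (*₃-mod n x₁ y₁ mod-refl mod-refl) (*₃-mod n x₂ y₂ mod-refl mod-refl)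

level-⊗₃ : ∀ n L M N → level n ((L ⊗ M) ⊗ N) ≡ᴹ level n L · level n M · level n N [mod 3^ n ]
level-⊗₃ n L M N =
  ≡ᴹ-trans (level-⊗ n (L ⊗ M) N) (·-cong-mod (level-⊗ n L M) (≡ᴹ-refl {A = level n N}))

level-I₂ : ∀ n → level n I₂ ≡ᴹ 1ᴹ [mod 3^ n ]
level-I₂ n = entrywise (md-mod n 1) (md-mod n 0) (md-mod n 0) (md-mod n 1)

det-level : ∀ n M → + det M n ≡ determinant (level n M) [mod 3^ n ]
det-level n M = +₃-mod n (a M *₃ d M) (-₃ (b M *₃ c M)) (*₃-mod n (a M) (d M) mod-refl mod-refl)
  (-₃-mod n (b M *₃ c M) (ℕ.<⇒≤ (md< n (b M n ℕ.* c M n))) (*₃-mod n (b M) (c M) mod-refl mod-refl))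

level-≈ : ∀ {M N} → M ≈ N → ∀ n → level n M ≡ level n N
level-≈ (p , q , r , s) n = ℤmat-cong (cong +_ (p n)) (cong +_ (q n)) (cong +_ (r n)) (cong +_ (s n))

Z₃-coherent : ∀ {x} → IsZ₃ x → ∀ n → + x (suc n) ≡ + x n [mod 3^ n ]
Z₃-coherent {x} (_ , x-coh) n =
  mod-trans (mod-sym (md-mod n (x (suc n)))) (mod-reflexive (cong +_ (x-coh n)))

Z₃-coherent-with-1 : ∀ {x} → IsZ₃ x → ∀ n → + x (suc n) ≡ + x 1 [mod + 3 ]
Z₃-coherent-with-1 zx zero    = mod-refl
Z₃-coherent-with-1 zx (suc n) = mod-trans
  (mod-weaken (3^ n) (mod-resp-modulus (3^-sucˡ n) (Z₃-coherent zx (suc n)))) (Z₃-coherent-with-1 zx n)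

level-suc : ∀ {M} → IsMat M → ∀ n → level (suc n) M ≡ᴹ level n M [mod 3^ n ]
level-suc (x , y , z , w) n =
  entrywise (Z₃-coherent x n) (Z₃-coherent y n) (Z₃-coherent z n) (Z₃-coherent w n)

level-suc-with-1 : ∀ {M} → IsMat M → ∀ n → level (suc n) M ≡ᴹ level 1 M [mod + 3 ]
level-suc-with-1 (x , y , z , w) n = entrywise
  (Z₃-coherent-with-1 x n) (Z₃-coherent-with-1 y n) (Z₃-coherent-with-1 z n) (Z₃-coherent-with-1 w n)

Reduced : ℕ → M2 → Set
Reduced n M = a M n ℕ.< 3 ℕ.^ n × b M n ℕ.< 3 ℕ.^ n × c M n ℕ.< 3 ℕ.^ n × d M n ℕ.< 3 ℕ.^ n

IsMat⇒Reduced : ∀ {M} → IsMat M → ∀ n → Reduced n M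
IsMat⇒Reduced ((x< , _) , (y< , _) , (z< , _) , (w< , _)) n = x< n , y< n , z< n , w< n

⊗-reduced : ∀ n M N → Reduced n (M ⊗ N)
⊗-reduced n M N = md< n _ , md< n _ , md< n _ , md< n _

I₂-reduced : ∀ n → Reduced n I₂
I₂-reduced n = md< n 1 , md< n 0 , md< n 0 , md< n 1

agree-if-congruent : ∀ n {M N} → Reduced n M → Reduced n N →
                     level n M ≡ᴹ level n N [mod 3^ n ] → M ≡[mod3^ n ] N
agree-if-congruent n (x< , y< , z< , w<) (x<′ , y<′ , z<′ , w<′) (entrywise p q r s) =
  residue-unique₃ n x< x<′ p , residue-unique₃ n y< y<′ q ,
  residue-unique₃ n z< z<′ r , residue-unique₃ n w< w<′ s

≈-if-agree : ∀ {M N} → (∀ n → M ≡[mod3^ n ] N) → M ≈ N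
≈-if-agree agree = (λ n → proj₁ (agree n)) , (λ n → proj₁ (proj₂ (agree n))) ,
                   (λ n → proj₁ (proj₂ (proj₂ (agree n)))) , (λ n → proj₂ (proj₂ (proj₂ (agree n))))

⊗-≈-I₂ : ∀ {M N} → (∀ n → level n M · level n N ≡ᴹ 1ᴹ [mod 3^ n ]) → (M ⊗ N) ≈ I₂
⊗-≈-I₂ {M} {N} inverse-at = ≈-if-agree λ n →
  agree-if-congruent n {M ⊗ N} {I₂} (⊗-reduced n M N) (I₂-reduced n)
    (≡ᴹ-trans (level-⊗ n M N) (≡ᴹ-trans (inverse-at n) (≡ᴹ-sym (level-I₂ n))))

⊗-≈-I₂⇒levels : ∀ {M N} → (M ⊗ N) ≈ I₂ → ∀ n → level n M · level n N ≡ᴹ 1ᴹ [mod 3^ n ]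
⊗-≈-I₂⇒levels {M} {N} MN≈I n =
  ≡ᴹ-trans (≡ᴹ-sym (level-⊗ n M N)) (≡ᴹ-trans (≡ᴹ-reflexive (level-≈ MN≈I n)) (level-I₂ n))

constantSeq-IsZ₃ : ∀ z → IsZ₃ (constantSeq z)
constantSeq-IsZ₃ z = below , λ n → residue-unique₃ n (md< n _) (below n)
  (mod-trans (md-mod n _)
    (mod-trans (mod-weaken (+ 3) (mod-resp-modulus (3^-suc n) (constantSeq-mod z (suc n))))
      (mod-sym (constantSeq-mod z n))))
  where
  below : ∀ n → constantSeq z n ℕ.< 3 ℕ.^ n
  below n = ℤ.n%ℕd<d z (3 ℕ.^ n) {{3^-nonZero n}}

constant : ℤMat → M2
constant A = mat (constantSeq (m₁₁ A)) (constantSeq (m₁₂ A)) (constantSeq (m₂₁ A)) (constantSeq (m₂₂ A))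

level-constant : ∀ A n → level n (constant A) ≡ᴹ A [mod 3^ n ]
level-constant A n = entrywise
  (constantSeq-mod (m₁₁ A) n) (constantSeq-mod (m₁₂ A) n)
  (constantSeq-mod (m₂₁ A) n) (constantSeq-mod (m₂₂ A) n)

constant-IsMat : ∀ A → IsMat (constant A)
constant-IsMat A =
  constantSeq-IsZ₃ (m₁₁ A) , constantSeq-IsZ₃ (m₁₂ A) , constantSeq-IsZ₃ (m₂₁ A) , constantSeq-IsZ₃ (m₂₂ A)

record GL₂ℤ : Set where
  field
    el el⁻¹ : ℤMat
    el·el⁻¹ : el · el⁻¹ ≡ 1ᴹ
    el⁻¹·el : el⁻¹ · el ≡ 1ᴹ
open GL₂ℤ

constant-⊗-≈-I₂ : ∀ {A B} → A · B ≡ 1ᴹ → (constant A ⊗ constant B) ≈ I₂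
constant-⊗-≈-I₂ {A} {B} AB≡1 = ⊗-≈-I₂ {constant A} λ n →
  ≡ᴹ-trans (·-cong-mod (level-constant A n) (level-constant B n)) (≡ᴹ-reflexive AB≡1)

constant-IsInverse : ∀ g → IsInverse (constant (el g)) (constant (el⁻¹ g))
constant-IsInverse g =
  constant-IsMat (el⁻¹ g) , constant-⊗-≈-I₂ {el g} (el·el⁻¹ g) , constant-⊗-≈-I₂ {el⁻¹ g} (el⁻¹·el g)

constant-IsGL : ∀ g → IsGL (constant (el g))
constant-IsGL g = constant-IsMat (el g) , constant (el⁻¹ g) , constant-IsInverse g

level-conjugate : ∀ g M n →
  level n ((constant (el g) ⊗ M) ⊗ constant (el⁻¹ g)) ≡ᴹ el g · level n M · el⁻¹ g [mod 3^ n ]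
level-conjugate g M n = ≡ᴹ-trans (level-⊗₃ n (constant (el g)) M (constant (el⁻¹ g)))
  (·-cong-mod (·-cong-mod (level-constant (el g) n) (≡ᴹ-refl {A = level n M})) (level-constant (el⁻¹ g) n))

Unimodular : M2 → Set
Unimodular M = ∀ n → determinant (level n M) ≡ + 1 [mod 3^ n ]

unimodular-⊗ : ∀ {M N} → Unimodular M → Unimodular N → Unimodular (M ⊗ N)
unimodular-⊗ {M} {N} det-M det-N n = mod-trans (determinant-cong-mod (level-⊗ n M N))
  (mod-trans (mod-reflexive (determinant-· (level n M) (level n N))) (*-cong-mod (det-M n) (det-N n)))

unimodular-I₂ : Unimodular I₂
unimodular-I₂ n = determinant-cong-mod (level-I₂ n)

IsSL⇒Unimodular : ∀ {G} → IsSL G → Unimodular G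
IsSL⇒Unimodular {G} (_ , det≡1) n =
  mod-trans (mod-sym (det-level n G)) (mod-trans (mod-reflexive (cong +_ (det≡1 n))) (md-mod n 1))

adjugate₃ : M2 → M2
adjugate₃ G = mat (d G) (-₃ (b G)) (-₃ (c G)) (a G)

-₃-IsZ₃ : ∀ {x} → IsZ₃ x → IsZ₃ (-₃ x)
-₃-IsZ₃ {x} zx@(x< , _) = (λ n → md< n _) , λ n → residue-unique₃ n (md< n _) (md< n _)
  (mod-trans (md-mod n _) (mod-trans (mod-weaken (+ 3) (mod-resp-modulus (3^-suc n) (negated (suc n))))
    (mod-trans (neg-cong-mod (Z₃-coherent zx n)) (mod-sym (negated n)))))
  where
  negated : ∀ n → + (-₃ x) n ≡ - + x n [mod 3^ n ]
  negated n = -₃-mod n x (ℕ.<⇒≤ (x< n)) mod-refl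

level-adjugate₃ : ∀ {G} → IsMat G → ∀ n → level n (adjugate₃ G) ≡ᴹ adjugate (level n G) [mod 3^ n ]
level-adjugate₃ {G} ((a< , _) , (b< , _) , (c< , _) , (d< , _)) n = entrywise mod-refl
  (-₃-mod n (b G) (ℕ.<⇒≤ (b< n)) mod-refl) (-₃-mod n (c G) (ℕ.<⇒≤ (c< n)) mod-refl) mod-refl

IsSL⇒IsGL : ∀ {G} → IsSL G → IsGL G
IsSL⇒IsGL {G} sl@(G-mat@(za , zb , zc , zd) , _) =
  G-mat , adjugate₃ G , (zd , -₃-IsZ₃ zb , -₃-IsZ₃ zc , za) , ⊗-≈-I₂ {G} right , ⊗-≈-I₂ {adjugate₃ G} left
  where
  right : ∀ n → level n G · level n (adjugate₃ G) ≡ᴹ 1ᴹ [mod 3^ n ]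
  right n = ≡ᴹ-trans (·-cong-mod (≡ᴹ-refl {A = level n G}) (level-adjugate₃ G-mat n))
    (≡ᴹ-trans (≡ᴹ-reflexive (·-adjugate (level n G))) (⋆-≡1 1ᴹ (IsSL⇒Unimodular sl n)))
  left : ∀ n → level n (adjugate₃ G) · level n G ≡ᴹ 1ᴹ [mod 3^ n ]
  left n = ≡ᴹ-trans (·-cong-mod (level-adjugate₃ G-mat n) (≡ᴹ-refl {A = level n G}))
    (≡ᴹ-trans (≡ᴹ-reflexive (adjugate-· (level n G))) (⋆-≡1 1ᴹ (IsSL⇒Unimodular sl n)))

-- Reduction modulo 3

infix 4 _≟₃_
_≟₃_ : DecidableEquality M3
mat3 x₁ x₂ x₃ x₄ ≟₃ mat3 y₁ y₂ y₃ y₄ =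
  map′ (λ { (refl , refl , refl , refl) → refl }) (λ { refl → refl , refl , refl , refl })
       (x₁ ℕ.≟ y₁ ×-dec x₂ ℕ.≟ y₂ ×-dec x₃ ℕ.≟ y₃ ×-dec x₄ ℕ.≟ y₄)

mat3-cong : ∀ {x₁ x₂ x₃ x₄ y₁ y₂ y₃ y₄} → x₁ ≡ y₁ → x₂ ≡ y₂ → x₃ ≡ y₃ → x₄ ≡ y₄ →
            mat3 x₁ x₂ x₃ x₄ ≡ mat3 y₁ y₂ y₃ y₄
mat3-cong refl refl refl refl = refl

I₃ : M3
I₃ = mat3 1 0 0 1

product₃ : List M3 → M3
product₃ = foldr _·₃_ I₃

lift : M3 → ℤMat
lift X = ℤmat (+ e11 X) (+ e12 X) (+ e21 X) (+ e22 X)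

reduce₃ : ℤMat → M3
reduce₃ A = red3 (constant A)

lift-·₃ : ∀ X Y → lift (X ·₃ Y) ≡ᴹ lift X · lift Y [mod + 3 ]
lift-·₃ X Y = entrywise (entry (e11 X) (e11 Y) (e12 X) (e21 Y)) (entry (e11 X) (e12 Y) (e12 X) (e22 Y))
                        (entry (e21 X) (e11 Y) (e22 X) (e21 Y)) (entry (e21 X) (e12 Y) (e22 X) (e22 Y))
  where
  entry : ∀ x₁ y₁ x₂ y₂ → + m3 (x₁ ℕ.* y₁ ℕ.+ x₂ ℕ.* y₂) ≡ + x₁ * + y₁ + + x₂ * + y₂ [mod + 3 ]
  entry x₁ y₁ x₂ y₂ = mod-trans (md-mod 1 _) (mod-reflexive (begin
    + (x₁ ℕ.* y₁ ℕ.+ x₂ ℕ.* y₂)   ≡⟨ ℤ.pos-+ (x₁ ℕ.* y₁) (x₂ ℕ.* y₂) ⟩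
    + (x₁ ℕ.* y₁) + + (x₂ ℕ.* y₂) ≡⟨ cong₂ _+_ (ℤ.pos-* x₁ y₁) (ℤ.pos-* x₂ y₂) ⟩
    + x₁ * + y₁ + + x₂ * + y₂     ∎))
    where open ≡-Reasoning

≡ᴹ-if-reduce₃≡ : ∀ {A B} → reduce₃ A ≡ reduce₃ B → A ≡ᴹ B [mod + 3 ]
≡ᴹ-if-reduce₃≡ {A} {B} A≡B =
  ≡ᴹ-trans (≡ᴹ-sym (level-constant A 1)) (≡ᴹ-trans (≡ᴹ-reflexive (cong lift A≡B)) (level-constant B 1))

red3-⊗ : ∀ M N → red3 (M ⊗ N) ≡ red3 M ·₃ red3 N
red3-⊗ M N = mat3-cong (entry (a M) (a N) (b M) (c N)) (entry (a M) (b N) (b M) (d N))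
                       (entry (c M) (a N) (d M) (c N)) (entry (c M) (b N) (d M) (d N))
  where
  entry : ∀ x₁ y₁ x₂ y₂ → ((x₁ *₃ y₁) +₃ (x₂ *₃ y₂)) 1 ≡ m3 (x₁ 1 ℕ.* y₁ 1 ℕ.+ x₂ 1 ℕ.* y₂ 1)
  entry x₁ y₁ x₂ y₂ = sym (ℕ.%-distribˡ-+ (x₁ 1 ℕ.* y₁ 1) (x₂ 1 ℕ.* y₂ 1) 3)

red3-inverse : ∀ {M N} → (M ⊗ N) ≈ I₂ → red3 M ·₃ red3 N ≡ I₃
red3-inverse {M} {N} (p , q , r , s) = trans (sym (red3-⊗ M N)) (mat3-cong (p 1) (q 1) (r 1) (s 1))

residue-of-≡1 : ∀ {x} → x ≡ + 1 [mod + 3 ] → x %ℕ 3 ≡ 1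
residue-of-≡1 {x} x≡1 =
  residue-unique 3 (ℤ.n%ℕd<d x 3) (s≤s (s≤s z≤n)) (mod-trans (constantSeq-mod x 1) x≡1)

words : {A : Set} → ℕ → List A → List (List A)
words zero    gs = [] ∷ []
words (suc k) gs = [] ∷ concatMap (λ g → map (g ∷_) (words k gs)) gs

words-over : ∀ {A : Set} k (gs : List A) {w} → w ∈ words k gs → All (_∈ gs) w
words-over zero    gs (here refl) = All.[]
words-over (suc k) gs (here refl) = All.[]
words-over (suc k) gs (there w∈) with find (∈-concatMap⁻ (λ g → map (g ∷_) (words k gs)) {xs = gs} w∈)
... | g , g∈gs , w∈gw with ∈-map⁻ (g ∷_) w∈gw
...   | w′ , w′∈ , refl = g∈gs All.∷ words-over k gs w′∈

residues<3 : {P : ℕ → Set} → P 0 → P 1 → P 2 → ∀ x → x ℕ.< 3 → P x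
residues<3 p₀ p₁ p₂ 0 _ = p₀
residues<3 p₀ p₁ p₂ 1 _ = p₁
residues<3 p₀ p₁ p₂ 2 _ = p₂
residues<3 p₀ p₁ p₂ (suc (suc (suc _))) (s≤s (s≤s (s≤s ())))

all<3? : {P : ℕ → Set} → Decidable P → Dec (∀ x → x ℕ.< 3 → P x)
all<3? P? = map′ (λ (p₀ , p₁ , p₂) → residues<3 p₀ p₁ p₂)
                 (λ all → all 0 (s≤s z≤n) , all 1 (s≤s (s≤s z≤n)) , all 2 (s≤s (s≤s (s≤s z≤n))))
                 (P? 0 ×-dec P? 1 ×-dec P? 2)

AllResidues : (M3 → Set) → Set
AllResidues P = ∀ x₁ → x₁ ℕ.< 3 → ∀ x₂ → x₂ ℕ.< 3 → ∀ x₃ → x₃ ℕ.< 3 → ∀ x₄ → x₄ ℕ.< 3 →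
                P (mat3 x₁ x₂ x₃ x₄)

allResidues? : {P : M3 → Set} → Decidable P → Dec (AllResidues P)
allResidues? P? = all<3? λ x₁ → all<3? λ x₂ → all<3? λ x₃ → all<3? λ x₄ → P? (mat3 x₁ x₂ x₃ x₄)

at-residue : ∀ {P : M3 → Set} → AllResidues P → ∀ {M} → IsMat M → P (red3 M)
at-residue all M-mat with IsMat⇒Reduced M-mat 1
... | a< , b< , c< , d< = all _ a< _ b< _ c< _ d<

residue-matrices : List M3
residue-matrices = concatMap (λ x₁ → concatMap (λ x₂ → concatMap (λ x₃ → map (mat3 x₁ x₂ x₃) r) r) r) r
  where
  r : List ℕ
  r = 0 ∷ 1 ∷ 2 ∷ []

IsSL𝔽₃? : Decidable IsSL𝔽₃
IsSL𝔽₃? X = e11 X ℕ.<? 3 ×-dec e12 X ℕ.<? 3 ×-dec e21 X ℕ.<? 3 ×-dec e22 X ℕ.<? 3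
            ×-dec m3 (e11 X ℕ.* e22 X ℕ.+ 2 ℕ.* (e12 X ℕ.* e21 X)) ℕ.≟ 1

SL₂𝔽₃ : List M3
SL₂𝔽₃ = filter IsSL𝔽₃? residue-matrices

IsSLCommutator : M3 → Set
IsSLCommutator Z = Any (λ (X , Y) → commutator X Y ≡ Z) (cartesianProduct SL₂𝔽₃ SL₂𝔽₃)

IsSLCommutator⇒InCommSL𝔽₃ : ∀ {Z} → IsSLCommutator Z → InCommSL𝔽₃ Z
IsSLCommutator⇒InCommSL𝔽₃ [X,Y]≡Z with find [X,Y]≡Z
... | (X , Y) , XY∈ , refl with ∈-cartesianProduct⁻ SL₂𝔽₃ SL₂𝔽₃ XY∈
...   | X∈ , Y∈ = gen (is-SL X∈) (is-SL Y∈)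
  where
  is-SL : ∀ {Z} → Z ∈ SL₂𝔽₃ → IsSL𝔽₃ Z
  is-SL Z∈ = proj₂ (∈-filter⁻ IsSL𝔽₃? {xs = residue-matrices} Z∈)

u₃ l⁻¹₃ : M3
u₃   = mat3 1 1 0 1
l⁻¹₃ = mat3 1 0 2 1

-- Found by a search over GL₂(𝔽₃); no two elements suffice.
commutator-conjugators : List GL₂ℤ
commutator-conjugators =
    record { el = ℤmat (+ 0) (+ 1) (+ 1) (+ 1) ; el⁻¹ = ℤmat (- + 1) (+ 1) (+ 1) (+ 0)
           ; el·el⁻¹ = refl ; el⁻¹·el = refl }
  ∷ record { el = ℤmat (+ 1) (- + 1) (+ 0) (+ 1) ; el⁻¹ = ℤmat (+ 1) (+ 1) (+ 0) (+ 1)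
           ; el·el⁻¹ = refl ; el⁻¹·el = refl }
  ∷ record { el = ℤmat (+ 1) (+ 0) (- + 1) (+ 1) ; el⁻¹ = ℤmat (+ 1) (+ 0) (+ 1) (+ 1)
           ; el·el⁻¹ = refl ; el⁻¹·el = refl }
  ∷ []

commutator₃ : GL₂ℤ → M3 → M3 → M3
commutator₃ g X X′ = ((reduce₃ (el g) ·₃ X) ·₃ reduce₃ (el⁻¹ g)) ·₃ X′

lift-commutator₃ : ∀ g X X′ → lift (commutator₃ g X X′) ≡ᴹ el g · lift X · el⁻¹ g · lift X′ [mod + 3 ]
lift-commutator₃ g X X′ = begin
  lift (((G ·₃ X) ·₃ G′) ·₃ X′)     ≈⟨ lift-·₃ ((G ·₃ X) ·₃ G′) X′ ⟩
  lift ((G ·₃ X) ·₃ G′) · lift X′   ≈⟨ ·-cong-mod (lift-·₃ (G ·₃ X) G′) (≡ᴹ-refl {A = lift X′}) ⟩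
  lift (G ·₃ X) · lift G′ · lift X′ ≈⟨ ·-cong-mod (·-cong-mod (lift-·₃ G X) (≡ᴹ-refl {A = lift G′}))
                                                  (≡ᴹ-refl {A = lift X′}) ⟩
  lift G · lift X · lift G′ · lift X′
    ≈⟨ ·-cong-mod (·-cong-mod (·-cong-mod (level-constant (el g) 1) (≡ᴹ-refl {A = lift X}))
                              (level-constant (el⁻¹ g) 1))
                  (≡ᴹ-refl {A = lift X′}) ⟩
  el g · lift X · el⁻¹ g · lift X′  ∎
  where
  open ≡ᴹ-Reasoning (+ 3)
  G G′ : M3
  G = reduce₃ (el g)
  G′ = reduce₃ (el⁻¹ g)

UnipotentFromCommutators : M3 → M3 → Set
UnipotentFromCommutators X X′ =
  Any (λ w → product₃ w ≡ u₃) (words 3 (map (λ g → commutator₃ g X X′) commutator-conjugators))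

-- Both proofs are found by evaluating the decision procedures; they are opaque so that this
-- evaluation is not repeated wherever they are used.
opaque
  unipotent-or-SL-commutator : AllResidues λ X → AllResidues λ X′ →
    X ·₃ X′ ≡ I₃ → UnipotentFromCommutators X X′ ⊎ IsSLCommutator X
  unipotent-or-SL-commutator = toWitness {a? = allResidues? λ X → allResidues? λ X′ →
    (X ·₃ X′ ≟₃ I₃) →-dec (any? (λ w → product₃ w ≟₃ u₃) _
                            ⊎-dec any? (λ (Y , Z) → commutator Y Z ≟₃ X) (cartesianProduct SL₂𝔽₃ SL₂𝔽₃))} _

  SL₂𝔽₃-generated : AllResidues λ T →
    determinant (lift T) %ℕ 3 ≡ 1 → Any (λ w → product₃ w ≡ T) (words 6 (u₃ ∷ l⁻¹₃ ∷ []))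
  SL₂𝔽₃-generated = toWitness {a? = allResidues? λ T →
    (determinant (lift T) %ℕ 3 ℕ.≟ 1) →-dec any? (λ w → product₃ w ≟₃ T) (words 6 (u₃ ∷ l⁻¹₃ ∷ []))} _

-- The kernel of reduction modulo 3ⁿ⁺¹

square-negligible : ∀ k → 3^ suc k * 3^ suc k ≡ + 0 [mod 3^ suc (suc k) ]
square-negligible k = mod-trans (mod-reflexive (begin
  3^ suc k * 3^ suc k         ≡⟨ cong₂ _*_ (3^-sucˡ k) (3^-sucˡ k) ⟩
  (+ 3 * 3^ k) * (+ 3 * 3^ k) ≡⟨ regroup (3^ k) ⟩
  3^ k * (+ 3 * (+ 3 * 3^ k)) ≡˘⟨ cong (λ z → 3^ k * (+ 3 * z)) (3^-sucˡ k) ⟩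
  3^ k * (+ 3 * 3^ suc k)     ≡˘⟨ cong (3^ k *_) (3^-sucˡ (suc k)) ⟩
  3^ k * 3^ suc (suc k)       ∎)) (multiple≡0-mod (3^ k))
  where
  open ≡-Reasoning
  regroup : ∀ x → (+ 3 * x) * (+ 3 * x) ≡ x * (+ 3 * (+ 3 * x))
  regroup x = solve (x ∷ [])

traceless-if-unipotent : ∀ k A → determinant (1ᴹ ⊕ 3^ suc k ⋆ A) ≡ + 1 [mod 3^ suc (suc k) ] →
                         trace A ≡ + 0 [mod + 3 ]
traceless-if-unipotent k A det≡1 = *-cancelˡ-mod (3^ suc k) {{3^-nonZero (suc k)}}
  (mod-resp-modulus (3^-suc (suc k)) (mod-trans (scaled-trace≡0 {t = 3^ suc k} (square-negligible k) A det≡1)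
                                                (mod-reflexive (sym (ℤ.*-zeroʳ (3^ suc k))))))

elementary : ℤ → GL₂ℤ
elementary t = record
  { el = 1ᴹ ⊕ t ⋆ E₁₂
  ; el⁻¹ = 1ᴹ ⊕ (- t) ⋆ E₁₂
  ; el·el⁻¹ = elementary-inverse t
  ; el⁻¹·el = subst (λ s → (1ᴹ ⊕ (- t) ⋆ E₁₂) · (1ᴹ ⊕ s ⋆ E₁₂) ≡ 1ᴹ) (ℤ.neg-involutive t)
                    (elementary-inverse (- t))
  }

kernel-generator : ℤMat → ℤMat → ℤMat
kernel-generator X X′ = E₁₂ ⊖ X · (E₁₂ · X′)

l l⁻¹ l² l⁻² w w⁻¹ : ℤMat
l   = ℤmat (+ 1) (+ 0) (+ 1) (+ 1)
l⁻¹ = ℤmat (+ 1) (+ 0) (- + 1) (+ 1)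
l²  = ℤmat (+ 1) (+ 0) (+ 2) (+ 1)
l⁻² = ℤmat (+ 1) (+ 0) (- + 2) (+ 1)
w   = ℤmat (+ 0) (- + 1) (+ 1) (+ 0)
w⁻¹ = ℤmat (+ 0) (+ 1) (- + 1) (+ 0)

w-GL : GL₂ℤ
w-GL = record { el = w ; el⁻¹ = w⁻¹ ; el·el⁻¹ = refl ; el⁻¹·el = refl }

-- The three generators are (1 0; 1 -1), (2 0; 4 -2) and (0 1; 1 0), a basis of the traceless
-- matrices over 𝔽₃; the coefficients are the coordinates of A in this basis.
traceless-combination : ∀ A → trace A ≡ + 0 [mod + 3 ] →
  (+ 2 * m₁₁ A + m₁₂ A + + 2 * m₂₁ A) ⋆ kernel-generator l l⁻¹
    ⊕ (m₁₁ A + m₁₂ A + + 2 * m₂₁ A) ⋆ kernel-generator l² l⁻²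
    ⊕ m₁₂ A ⋆ kernel-generator w w⁻¹ ≡ᴹ A [mod + 3 ]
traceless-combination (ℤmat p q r s) (k , p+s≡3k) =
  entrywise (p + q + + 2 * r , e₁₁) (+ 0 , e₁₂) (+ 2 * p + + 2 * q + + 3 * r , e₂₁)
            (mod-trans (- (p + q + + 2 * r) , e₂₂) (- k , -p-s≡-3k))
  where
  e₁₁ : (+ 2 * p + q + + 2 * r) * + 1 + (p + q + + 2 * r) * + 2 + q * + 0 - p ≡ (p + q + + 2 * r) * + 3
  e₁₁ = solve (p ∷ q ∷ r ∷ [])
  e₁₂ : (+ 2 * p + q + + 2 * r) * + 0 + (p + q + + 2 * r) * + 0 + q * + 1 - q ≡ + 0 * + 3
  e₁₂ = solve (p ∷ q ∷ r ∷ [])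
  e₂₁ : (+ 2 * p + q + + 2 * r) * + 1 + (p + q + + 2 * r) * + 4 + q * + 1 - r
      ≡ (+ 2 * p + + 2 * q + + 3 * r) * + 3
  e₂₁ = solve (p ∷ q ∷ r ∷ [])
  e₂₂ : (+ 2 * p + q + + 2 * r) * - + 1 + (p + q + + 2 * r) * - + 2 + q * + 0 - - p
      ≡ - (p + q + + 2 * r) * + 3
  e₂₂ = solve (p ∷ q ∷ r ∷ [])
  -p-s≡-3k : - p - s ≡ - k * + 3
  -p-s≡-3k = trans (negate p s) (trans (cong -_ p+s≡3k) (ℤ.neg-distribˡ-* k (+ 3)))
    where
    negate : ∀ x y → - x - y ≡ - (x + y - + 0)
    negate x y = solve (x ∷ y ∷ [])

-- Realisation by H ∩ SL₂(ℤ₃)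

module Realisation (H : M2 → Set) (H-closed-normal : IsClosedNormalSubgroup H) where
  open IsClosedNormalSubgroup H-closed-normal

  record Realised (n : ℕ) (T : ℤMat) : Set where
    constructor realised
    field
      element    : M2
      ∈H         : H element
      unimodular : Unimodular element
      reduces-to : level n element ≡ᴹ T [mod 3^ n ]

  Onto : ℕ → Set
  Onto n = ∀ T → determinant T ≡ + 1 [mod 3^ n ] → Realised n T

  realised-resp : ∀ {n A B} → A ≡ᴹ B [mod 3^ n ] → Realised n A → Realised n B
  realised-resp A≡B (realised M M∈H det-M M≡A) = realised M M∈H det-M (≡ᴹ-trans M≡A A≡B)

  realised-1 : ∀ {n} → Realised n 1ᴹ
  realised-1 {n} = realised I₂ has-id unimodular-I₂ (level-I₂ n)

  realised-· : ∀ {n A B} → Realised n A → Realised n B → Realised n (A · B)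
  realised-· {n} (realised M M∈H det-M M≡A) (realised N N∈H det-N N≡B) =
    realised (M ⊗ N) (∙-closed M∈H N∈H) (unimodular-⊗ {M} {N} det-M det-N)
             (≡ᴹ-trans (level-⊗ n M N) (·-cong-mod M≡A N≡B))

  realised-conjugate : ∀ {n A} g → Realised n A → Realised n (el g · A · el⁻¹ g)
  realised-conjugate {n} g (realised M M∈H det-M M≡A) =
    realised C (normal (constant-IsGL g) (constant-IsInverse g) M∈H) det-C
      (≡ᴹ-trans (level-conjugate g M n)
                (·-cong-mod (·-cong-mod (≡ᴹ-refl {A = el g}) M≡A) (≡ᴹ-refl {A = el⁻¹ g})))
    where
    C : M2
    C = (constant (el g) ⊗ M) ⊗ constant (el⁻¹ g)
    det-C : Unimodular C
    det-C k = begin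
      determinant (level k C)                  ≈⟨ determinant-cong-mod (level-conjugate g M k) ⟩
      determinant (el g · level k M · el⁻¹ g)  ≡⟨ determinant-conjugate (el g) (el⁻¹ g) (level k M) (el·el⁻¹ g) ⟩
      determinant (level k M)                  ≈⟨ det-M k ⟩
      + 1                                      ∎
      where open mod-Reasoning (3^ k)

  realised-commutator : ∀ {x x′} → H x → IsInverse x x′ →
                        ∀ g n → Realised n (el g · level n x · el⁻¹ g · level n x′)
  realised-commutator {x} {x′} x∈H x′-inverse@(_ , xx′≈I , _) g n =
    realised (C ⊗ x′) C⊗x′∈H det-C (level-C n)
    where
    C : M2
    C = (constant (el g) ⊗ x) ⊗ constant (el⁻¹ g)
    C⊗x′∈H : H (C ⊗ x′)
    C⊗x′∈H = ∙-closed (normal (constant-IsGL g) (constant-IsInverse g) x∈H) (⁻¹-closed x∈H x′-inverse)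
    level-C : ∀ k → level k (C ⊗ x′) ≡ᴹ el g · level k x · el⁻¹ g · level k x′ [mod 3^ k ]
    level-C k = ≡ᴹ-trans (level-⊗ k C x′) (·-cong-mod (level-conjugate g x k) (≡ᴹ-refl {A = level k x′}))
    det-C : Unimodular (C ⊗ x′)
    det-C k = begin
      determinant (level k (C ⊗ x′))
        ≈⟨ determinant-cong-mod (level-C k) ⟩
      determinant (el g · X · el⁻¹ g · X′)
        ≡⟨ determinant-· (el g · X · el⁻¹ g) X′ ⟩
      determinant (el g · X · el⁻¹ g) * determinant X′
        ≡⟨ cong (_* determinant X′) (determinant-conjugate (el g) (el⁻¹ g) X (el·el⁻¹ g)) ⟩
      determinant X * determinant X′
        ≡˘⟨ determinant-· X X′ ⟩
      determinant (X · X′)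
        ≈⟨ determinant-cong-mod (⊗-≈-I₂⇒levels {x} {x′} xx′≈I k) ⟩
      + 1 ∎
      where
      open mod-Reasoning (3^ k)
      X X′ : ℤMat
      X = level k x
      X′ = level k x′

  Realised₁ : M3 → Set
  Realised₁ X = Realised 1 (lift X)

  realised₁-product : ∀ {w} → All Realised₁ w → Realised₁ (product₃ w)
  realised₁-product All.[]                 = realised-1
  realised₁-product (All._∷_ {x} {w} r rs) =
    realised-resp (≡ᴹ-sym (lift-·₃ x (product₃ w))) (realised-· r (realised₁-product rs))

  realised₁-words : ∀ {gs} k {w} → (∀ {z} → z ∈ gs → Realised₁ z) → w ∈ words k gs → Realised₁ (product₃ w)
  realised₁-words {gs} k gens w∈ = realised₁-product (All.map gens (words-over k gs w∈))

  realised₁-commutator : ∀ {x x′} → H x → IsInverse x x′ →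
    ∀ {z} → z ∈ map (λ g → commutator₃ g (red3 x) (red3 x′)) commutator-conjugators → Realised₁ z
  realised₁-commutator {x} {x′} x∈H x′-inverse z∈
    with ∈-map⁻ (λ g → commutator₃ g (red3 x) (red3 x′)) {xs = commutator-conjugators} z∈
  ... | g , _ , refl =
    realised-resp (≡ᴹ-sym (lift-commutator₃ g (red3 x) (red3 x′))) (realised-commutator x∈H x′-inverse g 1)

  unipotent-realised : ∀ {h} → H h → ¬ InKerφ₃ h → Realised₁ u₃
  unipotent-realised {h} h∈H h∉ker with ⊆GL h∈H
  ... | h-mat , h′ , h′-inverse@(h′-mat , hh′≈I , _)
    with at-residue (at-residue unipotent-or-SL-commutator h-mat) h′-mat (red3-inverse {h} {h′} hh′≈I)
  ... | inj₂ h̄-commutator = ⊥-elim (h∉ker (IsSLCommutator⇒InCommSL𝔽₃ h̄-commutator))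
  ... | inj₁ word with find word
  ...   | w , w∈ , w≡u = subst Realised₁ w≡u (realised₁-words 3 (realised₁-commutator h∈H h′-inverse) w∈)

  realised₁-generators : Realised₁ u₃ → ∀ {z} → z ∈ u₃ ∷ l⁻¹₃ ∷ [] → Realised₁ z
  realised₁-generators u₃-realised (here refl)         = u₃-realised
  realised₁-generators u₃-realised (there (here refl)) =
    realised-resp (≡ᴹ-if-reduce₃≡ refl) (realised-conjugate w-GL u₃-realised)

  onto-level-1 : Realised₁ u₃ → Onto 1
  onto-level-1 u₃-realised T det≡1 = realised-resp (level-constant T 1)
    (subst Realised₁ (proj₂ (proj₂ word))
           (realised₁-words 6 (realised₁-generators u₃-realised) (proj₁ (proj₂ word))))
    where
    residue≡1 : determinant (lift (reduce₃ T)) %ℕ 3 ≡ 1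
    residue≡1 = residue-of-≡1 (mod-trans (determinant-cong-mod (level-constant T 1)) det≡1)
    word : ∃ λ w → w ∈ words 6 (u₃ ∷ l⁻¹₃ ∷ []) × product₃ w ≡ reduce₃ T
    word = find (at-residue SL₂𝔽₃-generated (constant-IsMat T) residue≡1)

  Kernel : ℕ → ℤMat → Set
  Kernel k A = Realised (suc (suc k)) (1ᴹ ⊕ 3^ suc k ⋆ A)

  kernel-resp : ∀ {k A B} → A ≡ᴹ B [mod + 3 ] → Kernel k A → Kernel k B
  kernel-resp {k} A≡B = realised-resp (⊕-cong-mod (≡ᴹ-refl {A = 1ᴹ})
    (≡ᴹ-resp-modulus (sym (3^-suc (suc k))) (⋆-scale-mod (3^ suc k) A≡B)))

  kernel-⊕ : ∀ {k A B} → Kernel k A → Kernel k B → Kernel k (A ⊕ B)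
  kernel-⊕ {k} {A} {B} A∈ B∈ =
    realised-resp (unipotent-·-mod {t = 3^ suc k} (square-negligible k) A B) (realised-· A∈ B∈)

  kernel-0ᴹ : ∀ {k} → Kernel k 0ᴹ
  kernel-0ᴹ {k} = realised-resp (≡ᴹ-sym (⊕-negligible (≡ᴹ-reflexive (⋆-zeroʳ (3^ suc k))))) realised-1

  kernel-ℕ-multiple : ∀ {k A} → Kernel k A → ∀ e → Kernel k ((+ e) ⋆ A)
  kernel-ℕ-multiple {A = A} A∈ zero    = kernel-resp (≡ᴹ-sym (⋆-negligible A mod-refl)) kernel-0ᴹ
  kernel-ℕ-multiple {A = A} A∈ (suc e) =
    kernel-resp (≡ᴹ-reflexive (⋆-suc e A)) (kernel-⊕ (kernel-ℕ-multiple A∈ e) A∈)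

  kernel-multiple : ∀ {k A} → Kernel k A → ∀ z → Kernel k (z ⋆ A)
  kernel-multiple {A = A} A∈ z =
    kernel-resp (⋆-cong-mod (constantSeq-mod z 1) (≡ᴹ-refl {A = A})) (kernel-ℕ-multiple A∈ (constantSeq z 1))

  kernel-commutator : ∀ {k X X′} → Realised 1 X → X · X′ ≡ᴹ 1ᴹ [mod + 3 ] → Kernel k (kernel-generator X X′)
  kernel-commutator {k} {X} {X′} (realised x x∈H _ x₁≡X) XX′≡1 with ⊆GL x∈H
  ... | x-mat , x′ , x′-inverse@(x′-mat , xx′≈I , x′x≈I) =
    kernel-resp (⊖-cong-mod (≡ᴹ-refl {A = E₁₂}) (·-cong-mod xN≡X (·-cong-mod (≡ᴹ-refl {A = E₁₂}) x′N≡X′)))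
      (realised-resp (unipotent-commutator-mod {t = 3^ suc k} (square-negligible k)
                                               E₁₂ (level N x) (level N x′) (⊗-≈-I₂⇒levels {x} xx′≈I N))
        (realised-commutator x∈H x′-inverse (elementary (3^ suc k)) N))
    where
    N : ℕ
    N = suc (suc k)
    xN≡X : level N x ≡ᴹ X [mod + 3 ]
    xN≡X = ≡ᴹ-trans (level-suc-with-1 x-mat (suc k)) x₁≡X
    x′₁X≡1 : level 1 x′ · X ≡ᴹ 1ᴹ [mod + 3 ]
    x′₁X≡1 = ≡ᴹ-trans (·-cong-mod (≡ᴹ-refl {A = level 1 x′}) (≡ᴹ-sym x₁≡X)) (⊗-≈-I₂⇒levels {x′} x′x≈I 1)
    x′N≡X′ : level N x′ ≡ᴹ X′ [mod + 3 ]
    x′N≡X′ = ≡ᴹ-trans (level-suc-with-1 x′-mat (suc k)) (left-inverse-unique x′₁X≡1 XX′≡1)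

  kernel-traceless : Onto 1 → ∀ k A → trace A ≡ + 0 [mod + 3 ] → Kernel k A
  kernel-traceless onto₁ k A@(ℤmat p q r s) tr≡0 = kernel-resp (traceless-combination A tr≡0)
    (kernel-⊕ (kernel-⊕ (kernel-multiple (generator l l⁻¹ refl refl) (+ 2 * p + q + + 2 * r))
                        (kernel-multiple (generator l² l⁻² refl refl) (p + q + + 2 * r)))
              (kernel-multiple (generator w w⁻¹ refl refl) q))
    where
    generator : ∀ X X′ → determinant X ≡ + 1 → X · X′ ≡ 1ᴹ → Kernel k (kernel-generator X X′)
    generator X X′ det≡1 XX′≡1 = kernel-commutator (onto₁ X (mod-reflexive det≡1)) (≡ᴹ-reflexive XX′≡1)

  lift-step : Onto 1 → ∀ k → Onto (suc k) → Onto (suc (suc k))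
  lift-step onto₁ k onto T det≡1 =
    realised-resp (adjugate-correction {Y = Y} det-Y≡1 T) (realised-· Y-realised K-realised)
    where
    open Realised (onto T (mod-weaken (+ 3) (mod-resp-modulus (3^-suc (suc k)) det≡1)))
    Y : ℤMat
    Y = level (suc (suc k)) element
    Y-realised : Realised (suc (suc k)) Y
    Y-realised = realised element ∈H unimodular ≡ᴹ-refl
    det-Y≡1 : determinant Y ≡ + 1 [mod 3^ suc (suc k) ]
    det-Y≡1 = unimodular (suc (suc k))
    K≡1 : adjugate Y · T ≡ᴹ 1ᴹ [mod 3^ suc k ]
    K≡1 = adjugate-·-≡1 {Y = Y} (mod-weaken (+ 3) (mod-resp-modulus (3^-suc (suc k)) det-Y≡1))
            (≡ᴹ-trans (level-suc (proj₁ (⊆GL ∈H)) (suc k)) reduces-to)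
    A : ℤMat
    A = proj₁ (unipotent-decomposition K≡1)
    K≡1+3ⁿA : adjugate Y · T ≡ 1ᴹ ⊕ 3^ suc k ⋆ A
    K≡1+3ⁿA = proj₂ (unipotent-decomposition K≡1)
    K-realised : Realised (suc (suc k)) (adjugate Y · T)
    K-realised = subst (Realised (suc (suc k))) (sym K≡1+3ⁿA) (kernel-traceless onto₁ k A
      (traceless-if-unipotent k A (subst (λ K → determinant K ≡ + 1 [mod 3^ suc (suc k) ]) K≡1+3ⁿA
        (determinant-adjugate-·-≡1 {Y = Y} det-Y≡1 det≡1))))

  onto-level-0 : Onto 0
  onto-level-0 T _ =
    realised I₂ has-id unimodular-I₂ (entrywise (mod-one _ _) (mod-one _ _) (mod-one _ _) (mod-one _ _))

  onto-every-level : ∀ {h} → H h → ¬ InKerφ₃ h → ∀ n → Onto n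
  onto-every-level h∈H h∉ker zero          = onto-level-0
  onto-every-level h∈H h∉ker (suc zero)    = onto-level-1 (unipotent-realised h∈H h∉ker)
  onto-every-level h∈H h∉ker (suc (suc k)) =
    lift-step (onto-every-level h∈H h∉ker 1) k (onto-every-level h∈H h∉ker (suc k))

lemma7p13 : (H : M2 → Set) → IsClosedNormalSubgroup H →
            (∃ λ h → H h × ¬ InKerφ₃ h) → ∀ G → IsSL G → H G
lemma7p13 H H-closed-normal (h , h∈H , h∉ker) G G-SL = closed (IsSL⇒IsGL G-SL) approximation
  where
  open IsClosedNormalSubgroup H-closed-normal
  open Realisation H H-closed-normal
  approximation : ∀ n → ∃ λ M → H M × M ≡[mod3^ n ] G
  approximation n = element , ∈H ,
    agree-if-congruent n {element} {G} (IsMat⇒Reduced (proj₁ (⊆GL ∈H)) n) (IsMat⇒Reduced (proj₁ G-SL) n)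
                       reduces-to
    where open Realised (onto-every-level h∈H h∉ker n (level n G) (IsSL⇒Unimodular G-SL n))
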